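{- Let $d\ge 2$ be an integer with prime factorization $d=\prod_\ell p_\ell^{e_\ell}$ ($e_\ell\ge1$). There exists $\tau_d<1$ such that for every $i$ with $0\le i\le d-1$, $$T(N;d,i) = r_{d,i}N + \mathcal O(N^{\tau_d}) \quad (N\to\infty),$$ where $$r_{d,i} = \frac 1d\cdot \prod_{p_\ell \mid i} \frac{p_\ell}{p_\ell+1}\cdot\prod_{p_\ell\nmid i}\frac{p_\ell^2}{p_\ell^2-1},$$ the products ranging over the primes $p_\ell$ dividing $d$ (for $i=0$ every $p_\ell$ divides $i$).
   Context: The Stern sequence $(s(n))_{n\ge0}$ is defined by $s(0)=0$, $s(1)=1$, $s(2n)=s(n)$, $s(2n+1)=s(n)+s(n+1)$. For integers $N\ge1$, $d\ge2$ and $0\le i<d$, let $T(N;d,i)=|\{n: 0\le n<N,\ s(n)\equiv i \pmod d\}|$. -}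

module Defs where

open import Data.Nat using (ℕ; zero; suc; _+_; _*_; _∸_; _%_; _/_; NonZero; _≟_)
open import Data.Nat.Primality using (prime?)
open import Data.Nat.Divisibility using (_∣?_)
open import Data.Product using (_×_; _,_; proj₁)
open import Data.List using (List; upTo; filter; length; foldr)
open import Data.Integer using (+_)
open import Data.Rational as ℚ using (ℚ; 1ℚ)
open import Relation.Nullary using (_×-dec_; does)
open import Data.Bool using (if_then_else_)

-- Stern pair: sternPair n = (s n , s (n+1)), using
--   (s(2m), s(2m+1))   = (s m, s m + s(m+1))
--   (s(2m+1), s(2m+2)) = (s m + s(m+1), s(m+1)).
-- The first argument is fuel; fuel n suffices for argument n
-- (n halvings bring n to 0, and the even step at 0 gives (0,1) again).
sternStep : ℕ → ℕ × ℕ → ℕ × ℕ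
sternStep zero    (a , b) = (a , a + b)
sternStep (suc _) (a , b) = (a + b , b)

sternPair : ℕ → ℕ → ℕ × ℕ
sternPair zero    n = (0 , 1)
sternPair (suc k) n = sternStep (n % 2) (sternPair k (n / 2))

stern : ℕ → ℕ
stern n = proj₁ (sternPair n n)

T : (N d i : ℕ) → .{{NonZero d}} → ℕ
T N d i = length (filter (λ n → stern n % d ≟ i % d) (upTo N))

-- Local factor for a prime p dividing d:
--   p/(p+1) if p ∣ i, and p²/(p²-1) otherwise.
-- (p = 0,1 never occur since p is prime; for p = q+2, p²-1 = suc (p*p ∸ 2).)
localFactor : ℕ → ℕ → ℚ
localFactor zero i = 1ℚ
localFactor (suc zero) i = 1ℚ
localFactor p@(suc (suc q)) i =
  if does (p ∣? i)
  then (+ p) ℚ./ suc p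
  else (+ (p * p)) ℚ./ suc (p * p ∸ 2)

primeDivisors : ℕ → List ℕ
primeDivisors d = filter (λ p → prime? p ×-dec (p ∣? d)) (upTo (suc d))

r : (d i : ℕ) → .{{NonZero d}} → ℚ
r d i = ((+ 1) ℚ./ d) ℚ.* foldr (λ p acc → localFactor p i ℚ.* acc) 1ℚ (primeDivisors d)

_^ℚ_ : ℚ → ℕ → ℚ
x ^ℚ zero = 1ℚ
x ^ℚ suc n = x ℚ.* (x ^ℚ n)

-- Reading the binary digits of n from the top, (s(n), s(n+1)) is obtained from (0, 1) by the maps
-- (a, b) ↦ (a, a + b) and (a, b) ↦ (a + b, b). Modulo d these act on the primitive residue pairs
-- (no prime factor of d divides both entries), and counting the n of a dyadic block of length 2^k with
-- s(n) ≡ i means applying the transfer operator g ↦ g ∘ step₀ + g ∘ step₁ k times to the indicator of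
-- "first entry ≡ i". Both maps permute the primitive pairs, so the sum over them is multiplied by 2 at
-- each step; and Euclid's algorithm brings every primitive pair to (0, 1) in exactly m steps, so every
-- m steps shrink the oscillation by the factor (2^m − 1)/2^m. Each block count is therefore 2^k F/Z up
-- to (2^m − 1)^(k/m), where F/Z is the proportion of primitive pairs with first entry i, and blocks of
-- length about N^(Am/(Am+1)) with A = 2^m give T(N;d,i) = (F/Z) N + O(N^(Am/(Am+1))). A sieve over the
-- primes of d shows F/Z = r_{d,i}.

module Submission where

open import Function.Base using (id; _∘_)
open import Function.Bundles using (_⇔_; mk⇔; Equivalence)
open import Data.Bool.Base using (Bool; true; false; if_then_else_)
open import Data.Empty using (⊥-elim)
open import Data.Product.Base using (Σ; ∃-syntax; _×_; _,_; proj₁; proj₂)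
open import Data.Sum.Base using (inj₁; inj₂)
open import Data.List.Base using (List; []; _∷_; map; filter; upTo; applyUpTo; length; foldr)
open import Data.List.Membership.Propositional using (_∈_)
open import Data.List.Membership.Propositional.Properties using (∈-filter⁺; ∈-filter⁻; ∈-upTo⁺)
open import Data.List.Relation.Unary.All as All using (All; []; _∷_)
open import Data.List.Relation.Unary.AllPairs using (_∷_)
open import Data.List.Relation.Unary.Unique.Propositional using (Unique)
import Data.List.Relation.Unary.Unique.Propositional.Properties as Unique
open import Data.Nat.Base
open import Data.Nat.Properties
open import Data.Nat.DivMod
open import Data.Nat.Divisibility
open import Data.Nat.Coprimality as Coprimality using (Coprime)
open import Data.Nat.Primality
open import Data.Nat.Primality.Factorisation using (factorise)
open import Data.Nat.ListAction using (product)
open import Data.Nat.Solver using (module +-*-Solver)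
open import Relation.Nullary using (¬_; Dec; yes; no; does; ¬?; _×-dec_; contradiction)
open import Relation.Nullary.Decidable using (dec-true; dec-false; does-⇔)
open import Relation.Binary.PropositionalEquality hiding ([_])
open import Defs

-- Finite sums

𝟙 : Bool → ℕ
𝟙 true  = 1
𝟙 false = 0

𝟙≤1 : ∀ b → 𝟙 b ≤ 1
𝟙≤1 true  = ≤-refl
𝟙≤1 false = z≤n

∑< : ℕ → (ℕ → ℕ) → ℕ
∑< zero    g = 0
∑< (suc n) g = g 0 + ∑< n (g ∘ suc)

syntax ∑< n (λ x → e) = ∑[ x < n ] e

length-filter-applyUpTo : ∀ {A : Set} {P : A → Set} (P? : ∀ x → Dec (P x)) h N →
  length (filter P? (applyUpTo h N)) ≡ ∑[ n < N ] 𝟙 (does (P? (h n)))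
length-filter-applyUpTo P? h zero = refl
length-filter-applyUpTo P? h (suc N) with does (P? (h 0))
... | true  = cong suc (length-filter-applyUpTo P? (h ∘ suc) N)
... | false = length-filter-applyUpTo P? (h ∘ suc) N

∑-cong : ∀ n {g h} → (∀ x → x < n → g x ≡ h x) → ∑< n g ≡ ∑< n h
∑-cong zero    eq = refl
∑-cong (suc n) eq = cong₂ _+_ (eq 0 z<s) (∑-cong n (λ x x<n → eq (suc x) (s<s x<n)))

∑-mono-≤ : ∀ n {g h} → (∀ x → x < n → g x ≤ h x) → ∑< n g ≤ ∑< n h
∑-mono-≤ zero    le = z≤n
∑-mono-≤ (suc n) le = +-mono-≤ (le 0 z<s) (∑-mono-≤ n (λ x x<n → le (suc x) (s<s x<n)))

∑-const : ∀ n c → ∑[ _ < n ] c ≡ n * c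
∑-const zero    c = refl
∑-const (suc n) c = cong (c +_) (∑-const n c)

∑-distrib-+ : ∀ n g h → ∑[ x < n ] (g x + h x) ≡ ∑< n g + ∑< n h
∑-distrib-+ zero    g h = refl
∑-distrib-+ (suc n) g h = begin
  g 0 + h 0 + ∑[ x < n ] (g (suc x) + h (suc x))  ≡⟨ cong (g 0 + h 0 +_) (∑-distrib-+ n (g ∘ suc) (h ∘ suc)) ⟩
  g 0 + h 0 + (∑< n (g ∘ suc) + ∑< n (h ∘ suc))   ≡⟨ solve 4 (λ a b c d → a :+ b :+ (c :+ d) := a :+ c :+ (b :+ d)) refl (g 0) (h 0) _ _ ⟩
  g 0 + ∑< n (g ∘ suc) + (h 0 + ∑< n (h ∘ suc))   ∎
  where
  open ≡-Reasoning
  open +-*-Solver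

∑-distribˡ-* : ∀ n c g → ∑[ x < n ] (c * g x) ≡ c * ∑< n g
∑-distribˡ-* zero    c g = sym (*-zeroʳ c)
∑-distribˡ-* (suc n) c g =
  trans (cong (c * g 0 +_) (∑-distribˡ-* n c (g ∘ suc))) (sym (*-distribˡ-+ c (g 0) _))

∑-split : ∀ m n g → ∑< (m + n) g ≡ ∑< m g + ∑[ x < n ] g (m + x)
∑-split zero    n g = refl
∑-split (suc m) n g = trans (cong (g 0 +_) (∑-split m n (g ∘ suc))) (sym (+-assoc (g 0) _ _))

∑-blocks : ∀ M B g → ∑< (M * B) g ≡ ∑[ q < M ] ∑[ u < B ] g (u + q * B)
∑-blocks zero    B g = refl
∑-blocks (suc M) B g = trans (∑-split B (M * B) g) (cong₂ _+_
  (∑-cong B (λ u _ → cong g (sym (+-identityʳ u))))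
  (trans (∑-blocks M B (λ x → g (B + x)))
         (∑-cong M (λ q _ → ∑-cong B (λ u _ → cong g (x+[y+z]≡y+[x+z] B u (q * B)))))))
  where
  x+[y+z]≡y+[x+z] : ∀ x y z → x + (y + z) ≡ y + (x + z)
  x+[y+z]≡y+[x+z] x y z = trans (sym (+-assoc x y z)) (trans (cong (_+ z) (+-comm x y)) (+-assoc y x z))

∑-comm : ∀ m n (g : ℕ → ℕ → ℕ) → ∑[ a < m ] ∑[ b < n ] g a b ≡ ∑[ b < n ] ∑[ a < m ] g a b
∑-comm zero    n g = sym (trans (∑-const n 0) (*-zeroʳ n))
∑-comm (suc m) n g = trans (cong (∑[ b < n ] g 0 b +_) (∑-comm m n (g ∘ suc)))
                           (sym (∑-distrib-+ n (g 0) (λ b → ∑[ a < m ] g (suc a) b)))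

term≤∑ : ∀ n g {x} → x < n → g x ≤ ∑< n g
term≤∑ (suc n) g {zero}  _         = m≤m+n (g 0) _
term≤∑ (suc n) g {suc x} (s<s x<n) = ≤-trans (term≤∑ n (g ∘ suc) x<n) (m≤n+m _ (g 0))

∑-select : ∀ n (g : ℕ → ℕ) {t} → t < n → ∑[ a < n ] (𝟙 (does (a ≟ t)) * g a) ≡ g t
∑-select (suc n) g {zero} _ = begin
  g 0 + 0 + ∑[ a < n ] 0  ≡⟨ cong₂ _+_ (+-identityʳ (g 0)) (trans (∑-const n 0) (*-zeroʳ n)) ⟩
  g 0 + 0                 ≡⟨ +-identityʳ (g 0) ⟩
  g 0                     ∎
  where open ≡-Reasoning
∑-select (suc n) g {suc t} (s<s t<n) = ∑-select n (g ∘ suc) t<n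

∑-last : ∀ n g → ∑< (suc n) g ≡ ∑< n g + g n
∑-last n g = begin
  ∑< (suc n) g              ≡⟨ cong (λ k → ∑< k g) (+-comm 1 n) ⟩
  ∑< (n + 1) g              ≡⟨ ∑-split n 1 g ⟩
  ∑< n g + (g (n + 0) + 0)  ≡⟨ cong (∑< n g +_) (trans (+-identityʳ _) (cong g (+-identityʳ n))) ⟩
  ∑< n g + g n              ∎
  where open ≡-Reasoning

∑-rotate-suc : ∀ n .{{_ : NonZero n}} g → ∑[ c < n ] g (suc c % n) ≡ ∑< n g
∑-rotate-suc n@(suc m) g = begin
  ∑[ c < n ] g (suc c % n)              ≡⟨ ∑-last m (λ c → g (suc c % n)) ⟩
  ∑[ c < m ] g (suc c % n) + g (n % n)  ≡⟨ cong₂ _+_ (∑-cong m (λ c c<m → cong g (m<n⇒m%n≡m (s<s c<m)))) (cong g (n%n≡0 n)) ⟩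
  ∑[ c < m ] g (suc c) + g 0            ≡⟨ +-comm _ (g 0) ⟩
  ∑< n g                                ∎
  where open ≡-Reasoning

∑-rotate : ∀ n .{{_ : NonZero n}} a g → ∑[ b < n ] g ((a + b) % n) ≡ ∑< n g
∑-rotate n zero    g = ∑-cong n (λ b b<n → cong g (m<n⇒m%n≡m b<n))
∑-rotate n (suc a) g = begin
  ∑[ b < n ] g (suc (a + b) % n)        ≡⟨ ∑-cong n (λ b _ → cong g (sym (suc-%-absorb (a + b)))) ⟩
  ∑[ b < n ] g (suc ((a + b) % n) % n)  ≡⟨ ∑-rotate n a (λ c → g (suc c % n)) ⟩
  ∑[ c < n ] g (suc c % n)              ≡⟨ ∑-rotate-suc n g ⟩
  ∑< n g                                ∎
  where
  open ≡-Reasoning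
  suc-%-absorb : ∀ x → suc (x % n) % n ≡ suc x % n
  suc-%-absorb x = trans (%-distribˡ-+ 1 (x % n) n)
                  (trans (cong (λ y → (1 % n + y) % n) (m%n%n≡m%n x n)) (sym (%-distribˡ-+ 1 x n)))

c+n*lo≤∑ : ∀ n g {x c lo} → x < suc n → g x ≡ c → (∀ y → y < suc n → lo ≤ g y) → c + n * lo ≤ ∑< (suc n) g
c+n*lo≤∑ n g {zero} {c} {lo} _ refl lo≤g =
  +-monoʳ-≤ c (subst (_≤ ∑< n (g ∘ suc)) (∑-const n lo) (∑-mono-≤ n (λ y y<n → lo≤g (suc y) (s<s y<n))))
c+n*lo≤∑ (suc n) g {suc x} {c} {lo} (s<s x<n) gx≡c lo≤g = begin
  c + (lo + n * lo)           ≡⟨ solve 3 (λ c l m → c :+ (l :+ m) := l :+ (c :+ m)) refl c lo (n * lo) ⟩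
  lo + (c + n * lo)           ≤⟨ +-mono-≤ (lo≤g 0 z<s) (c+n*lo≤∑ n (g ∘ suc) x<n gx≡c (λ y y<n → lo≤g (suc y) (s<s y<n))) ⟩
  g 0 + ∑< (suc n) (g ∘ suc)  ∎
  where
  open ≤-Reasoning
  open +-*-Solver

∑≤c+n*hi : ∀ n g {x c hi} → x < suc n → g x ≡ c → (∀ y → y < suc n → g y ≤ hi) → ∑< (suc n) g ≤ c + n * hi
∑≤c+n*hi n g {zero} {c} {hi} _ refl g≤hi =
  +-monoʳ-≤ c (subst (∑< n (g ∘ suc) ≤_) (∑-const n hi) (∑-mono-≤ n (λ y y<n → g≤hi (suc y) (s<s y<n))))
∑≤c+n*hi (suc n) g {suc x} {c} {hi} (s<s x<n) gx≡c g≤hi = begin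
  g 0 + ∑< (suc n) (g ∘ suc)  ≤⟨ +-mono-≤ (g≤hi 0 z<s) (∑≤c+n*hi n (g ∘ suc) x<n gx≡c (λ y y<n → g≤hi (suc y) (s<s y<n))) ⟩
  hi + (c + n * hi)           ≡⟨ solve 3 (λ c h m → h :+ (c :+ m) := c :+ (h :+ m)) refl c hi (n * hi) ⟩
  c + (hi + n * hi)           ∎
  where
  open ≤-Reasoning
  open +-*-Solver

-- Stern pairs along binary digits

-- Feeds the k lowest binary digits of n to step, the most significant one first.
runBits : {X : Set} → (ℕ → X → X) → X → ℕ → ℕ → X
runBits step x zero    n = x
runBits step x (suc k) n = step (n % 2) (runBits step x k (n / 2))

runBits-concat : ∀ {X : Set} (step : ℕ → X → X) x k j q u → u < 2 ^ k →
                 runBits step x (k + j) (u + q * 2 ^ k) ≡ runBits step (runBits step x j q) k u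
runBits-concat step x zero    j q zero    _         = cong (runBits step x j) (*-identityʳ q)
runBits-concat step x zero    j q (suc u) (s<s ())
runBits-concat step x (suc k) j q u u<2^k+1 =
  cong₂ step (trans (cong (_% 2) u+q2^k+1≡) ([m+kn]%n≡m%n u (q * 2 ^ k) 2))
             (trans (cong (runBits step x (k + j)) (trans (cong (_/ 2) u+q2^k+1≡) halve))
                    (runBits-concat step x k j q (u / 2) (m<n*o⇒m/o<n u<2^k*2)))
  where
  u+q2^k+1≡ : u + q * (2 * 2 ^ k) ≡ u + q * 2 ^ k * 2
  u+q2^k+1≡ = cong (u +_) (trans (cong (q *_) (*-comm 2 (2 ^ k))) (sym (*-assoc q (2 ^ k) 2)))
  halve : (u + q * 2 ^ k * 2) / 2 ≡ u / 2 + q * 2 ^ k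
  halve = trans (+-distrib-/-∣ʳ u (divides-refl (q * 2 ^ k))) (cong (u / 2 +_) (m*n/n≡m (q * 2 ^ k) 2))
  u<2^k*2 : u < 2 ^ k * 2
  u<2^k*2 = subst (u <_) (*-comm 2 (2 ^ k)) u<2^k+1

n<2^n : ∀ n → n < 2 ^ n
n<2^n zero    = z<s
n<2^n (suc n) = ≤-<-trans (n<2^n n) (m<m+n (2 ^ n) (subst (0 <_) (sym (+-identityʳ (2 ^ n))) (m^n>0 2 n)))

stern₂ : ℕ → ℕ × ℕ
stern₂ n = sternPair n n

runStern : ℕ × ℕ → ℕ → ℕ → ℕ × ℕ
runStern = runBits sternStep

sternPair≡runStern : ∀ k n → sternPair k n ≡ runStern (0 , 1) k n
sternPair≡runStern zero    n = refl
sternPair≡runStern (suc k) n = cong (sternStep (n % 2)) (sternPair≡runStern k (n / 2))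

runStern-zero : ∀ k → runStern (0 , 1) k 0 ≡ (0 , 1)
runStern-zero zero    = refl
runStern-zero (suc k) = cong (sternStep 0) (runStern-zero k)

runStern-fuel : ∀ K t n → n < 2 ^ K → runStern (0 , 1) (K + t) n ≡ runStern (0 , 1) K n
runStern-fuel K t n n<2^K = begin
  runStern (0 , 1) (K + t) n                ≡⟨ cong (runStern (0 , 1) (K + t)) (sym (+-identityʳ n)) ⟩
  runStern (0 , 1) (K + t) (n + 0 * 2 ^ K)  ≡⟨ runBits-concat sternStep (0 , 1) K t 0 n n<2^K ⟩
  runStern (runStern (0 , 1) t 0) K n       ≡⟨ cong (λ x → runStern x K n) (runStern-zero t) ⟩
  runStern (0 , 1) K n                      ∎
  where open ≡-Reasoning

stern₂≡runStern : ∀ K n → n < 2 ^ K → stern₂ n ≡ runStern (0 , 1) K n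
stern₂≡runStern K n n<2^K = begin
  sternPair n n               ≡⟨ sternPair≡runStern n n ⟩
  runStern (0 , 1) n n        ≡⟨ sym (runStern-fuel n K n (n<2^n n)) ⟩
  runStern (0 , 1) (n + K) n  ≡⟨ cong (λ k → runStern (0 , 1) k n) (+-comm n K) ⟩
  runStern (0 , 1) (K + n) n  ≡⟨ runStern-fuel K n n n<2^K ⟩
  runStern (0 , 1) K n        ∎
  where open ≡-Reasoning

u+q*2^k<2^[k+j] : ∀ {u q} k j → u < 2 ^ k → q < 2 ^ j → u + q * 2 ^ k < 2 ^ (k + j)
u+q*2^k<2^[k+j] {u} {q} k j u<2^k q<2^j = begin-strict
  u + q * 2 ^ k  <⟨ +-monoˡ-< (q * 2 ^ k) u<2^k ⟩
  suc q * 2 ^ k  ≤⟨ *-monoˡ-≤ (2 ^ k) q<2^j ⟩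
  2 ^ j * 2 ^ k  ≡⟨ *-comm (2 ^ j) (2 ^ k) ⟩
  2 ^ k * 2 ^ j  ≡⟨ ^-distribˡ-+-* 2 k j ⟨
  2 ^ (k + j)    ∎
  where open ≤-Reasoning

stern₂-block : ∀ k q u → u < 2 ^ k → stern₂ (u + q * 2 ^ k) ≡ runStern (stern₂ q) k u
stern₂-block k q u u<2^k = begin
  stern₂ (u + q * 2 ^ k)                    ≡⟨ stern₂≡runStern (k + q) _ (u+q*2^k<2^[k+j] k q u<2^k (n<2^n q)) ⟩
  runStern (0 , 1) (k + q) (u + q * 2 ^ k)  ≡⟨ runBits-concat sternStep (0 , 1) k q q u u<2^k ⟩
  runStern (runStern (0 , 1) q q) k u       ≡⟨ cong (λ x → runStern x k u) (sym (stern₂≡runStern q q (n<2^n q))) ⟩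
  runStern (stern₂ q) k u                   ∎
  where open ≡-Reasoning

CoprimePair : ℕ × ℕ → Set
CoprimePair (a , b) = Coprime a b

sternStep-coprime : ∀ e v → CoprimePair v → CoprimePair (sternStep e v)
sternStep-coprime zero    (a , b) a⊥b (x∣a , x∣a+b) = a⊥b (x∣a , ∣m+n∣m⇒∣n x∣a+b x∣a)
sternStep-coprime (suc e) (a , b) a⊥b {x} (x∣a+b , x∣b) = a⊥b (∣m+n∣m⇒∣n (subst (x ∣_) (+-comm a b) x∣a+b) x∣b , x∣b)

stern₂-coprime : ∀ n → CoprimePair (stern₂ n)
stern₂-coprime n = subst CoprimePair (sym (sternPair≡runStern n n)) (go n n)
  where
  go : ∀ k n → CoprimePair (runStern (0 , 1) k n)
  go zero    n (_ , x∣1) = ∣1⇒≡1 x∣1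
  go (suc k) n = sternStep-coprime (n % 2) _ (go k (n / 2))

-- The Stern automaton modulo d

iterate : {A : Set} → (A → A) → ℕ → A → A
iterate f zero    x = x
iterate f (suc k) x = iterate f k (f x)

iterate-+ : ∀ {A : Set} (f : A → A) j k x → iterate f (j + k) x ≡ iterate f k (iterate f j x)
iterate-+ f zero    k x = refl
iterate-+ f (suc j) k x = iterate-+ f j k (f x)

NoCommonPrime : List ℕ → ℕ → ℕ → Set
NoCommonPrime ps a b = All (λ p → ¬ (p ∣ a × p ∣ b)) ps

noCommonPrime? : ∀ ps a b → Dec (NoCommonPrime ps a b)
noCommonPrime? ps a b = All.all? (λ p → ¬? ((p ∣? a) ×-dec (p ∣? b))) ps

χ : List ℕ → ℕ → ℕ → ℕ
χ ps a b = 𝟙 (does (noCommonPrime? ps a b))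

∈-primeDivisors⁻ : ∀ d {p} → p ∈ primeDivisors d → Prime p × p ∣ d
∈-primeDivisors⁻ d p∈ = proj₂ (∈-filter⁻ (λ p → prime? p ×-dec (p ∣? d)) {xs = upTo (suc d)} p∈)

∈-primeDivisors⁺ : ∀ {p d} .{{_ : NonZero d}} → Prime p → p ∣ d → p ∈ primeDivisors d
∈-primeDivisors⁺ {d = d} p-prime p∣d =
  ∈-filter⁺ (λ p → prime? p ×-dec (p ∣? d)) (∈-upTo⁺ (s≤s (∣⇒≤ p∣d))) (p-prime , p∣d)

primeDivisors-unique : ∀ d → Unique (primeDivisors d)
primeDivisors-unique d = Unique.filter⁺ (λ p → prime? p ×-dec (p ∣? d)) (Unique.upTo⁺ (suc d))

∃-prime-divisor : ∀ {n} → 1 < n → ∃[ p ] Prime p × p ∣ n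
∃-prime-divisor {n@(suc _)} 1<n with factorise n
... | record { factors = [] ; isFactorisation = n≡1 } = ⊥-elim (<⇒≢ 1<n (sym n≡1))
... | record { factors = p ∷ ps ; isFactorisation = n≡p*ps ; factorsPrime = p-prime ∷ _ } =
  p , p-prime , divides (product ps) (trans n≡p*ps (*-comm p _))

noCommonPrime-map : ∀ {ps a b a′ b′} → (∀ {p} → p ∈ ps → p ∣ a′ × p ∣ b′ → p ∣ a × p ∣ b) →
                    NoCommonPrime ps a b → NoCommonPrime ps a′ b′
noCommonPrime-map f ncp = All.tabulate (λ p∈ p∣a′b′ → All.lookup ncp p∈ (f p∈ p∣a′b′))

module SternModulo (d : ℕ) (1<d : 1 < d) where

  instance
    d≢0 : NonZero d
    d≢0 = >-nonZero (<-trans z<s 1<d)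

  reduce : ℕ × ℕ → ℕ × ℕ
  reduce (a , b) = (a % d , b % d)

  step : ℕ → ℕ × ℕ → ℕ × ℕ
  step e v = reduce (sternStep e v)

  run : ℕ × ℕ → ℕ → ℕ → ℕ × ℕ
  run = runBits step

  %-absorbʳ-+ : ∀ x y → (x + y % d) % d ≡ (x + y) % d
  %-absorbʳ-+ x y = trans (%-distribˡ-+ x (y % d) d)
    (trans (cong (λ z → (x % d + z) % d) (m%n%n≡m%n y d)) (sym (%-distribˡ-+ x y d)))

  %-absorbˡ-+ : ∀ x y → (x % d + y) % d ≡ (x + y) % d
  %-absorbˡ-+ x y = trans (cong (_% d) (+-comm (x % d) y)) (trans (%-absorbʳ-+ y x) (cong (_% d) (+-comm y x)))

  %-absorb-+ : ∀ x y → (x % d + y % d) % d ≡ (x + y) % d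
  %-absorb-+ x y = trans (%-absorbˡ-+ x (y % d)) (%-absorbʳ-+ x y)

  step-reduce : ∀ e v → step e (reduce v) ≡ step e v
  step-reduce zero    (a , b) = cong₂ _,_ (m%n%n≡m%n a d) (%-absorb-+ a b)
  step-reduce (suc e) (a , b) = cong₂ _,_ (%-absorb-+ a b) (m%n%n≡m%n b d)

  reduce-runStern : ∀ v k n → reduce (runStern v k n) ≡ run (reduce v) k n
  reduce-runStern v zero    n = refl
  reduce-runStern v (suc k) n = trans (sym (step-reduce (n % 2) (runStern v k (n / 2))))
                                      (cong (step (n % 2)) (reduce-runStern v k (n / 2)))

  primes : List ℕ
  primes = primeDivisors d

  Primitive : ℕ × ℕ → Set
  Primitive (a , b) = a < d × b < d × NoCommonPrime primes a b

  module _ {p} (p∈ : p ∈ primes) where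

    ∣%⇒∣ : ∀ {x} → p ∣ x % d → p ∣ x
    ∣%⇒∣ = ∣n∣m%n⇒∣m (proj₂ (∈-primeDivisors⁻ d p∈))

    ∣⇒∣% : ∀ {x} → p ∣ x → p ∣ x % d
    ∣⇒∣% p∣x = %-presˡ-∣ p∣x (proj₂ (∈-primeDivisors⁻ d p∈))

  step-primitive : ∀ e v → Primitive v → Primitive (step e v)
  step-primitive zero (a , b) (a<d , _ , ncp) =
    subst (_< d) (sym (m<n⇒m%n≡m a<d)) a<d , m%n<n _ d ,
    noCommonPrime-map (λ p∈ (p∣a , p∣a+b) → ∣%⇒∣ p∈ p∣a , ∣m+n∣m⇒∣n (∣%⇒∣ p∈ p∣a+b) (∣%⇒∣ p∈ p∣a)) ncp
  step-primitive (suc e) (a , b) (_ , b<d , ncp) =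
    m%n<n _ d , subst (_< d) (sym (m<n⇒m%n≡m b<d)) b<d ,
    noCommonPrime-map (λ {p} p∈ (p∣a+b , p∣b) → ∣m+n∣m⇒∣n (subst (p ∣_) (+-comm a b) (∣%⇒∣ p∈ p∣a+b)) (∣%⇒∣ p∈ p∣b) , ∣%⇒∣ p∈ p∣b) ncp

  run-primitive : ∀ v k n → Primitive v → Primitive (run v k n)
  run-primitive v zero    n pv = pv
  run-primitive v (suc k) n pv = step-primitive (n % 2) _ (run-primitive v k (n / 2) pv)

  reduce-coprime : ∀ v → CoprimePair v → Primitive (reduce v)
  reduce-coprime (a , b) a⊥b = m%n<n a d , m%n<n b d , All.tabulate p∤gcd
    where
    p∤gcd : ∀ {p} → p ∈ primes → ¬ (p ∣ a % d × p ∣ b % d)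
    p∤gcd p∈ (p∣a , p∣b) = ¬prime[1] (subst Prime (a⊥b (∣%⇒∣ p∈ p∣a , ∣%⇒∣ p∈ p∣b)) (proj₁ (∈-primeDivisors⁻ d p∈)))

  transfer : (ℕ × ℕ → ℕ) → ℕ × ℕ → ℕ
  transfer g v = g (step 0 v) + g (step 1 v)

  ∑-run≡transfer : ∀ k g v → ∑[ n < 2 ^ k ] g (run v k n) ≡ iterate transfer k g v
  ∑-run≡transfer zero    g v = +-identityʳ (g v)
  ∑-run≡transfer (suc k) g v = begin
    ∑[ n < 2 * 2 ^ k ] g (run v (suc k) n)                   ≡⟨ cong (λ B → ∑< B (g ∘ run v (suc k))) (*-comm 2 (2 ^ k)) ⟩
    ∑[ n < 2 ^ k * 2 ] g (run v (suc k) n)                   ≡⟨ ∑-blocks (2 ^ k) 2 (g ∘ run v (suc k)) ⟩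
    ∑[ q < 2 ^ k ] ∑[ u < 2 ] g (run v (suc k) (u + q * 2))  ≡⟨ ∑-cong (2 ^ k) (λ q _ → children q) ⟩
    ∑[ q < 2 ^ k ] transfer g (run v k q)                    ≡⟨ ∑-run≡transfer k (transfer g) v ⟩
    iterate transfer k (transfer g) v                        ∎
    where
    open ≡-Reasoning
    last-bit : ∀ u q → u < 2 → run v (suc k) (u + q * 2) ≡ step u (run v k q)
    last-bit u q u<2 = cong₂ (λ e n → step e (run v k n))
      (trans ([m+kn]%n≡m%n u q 2) (m<n⇒m%n≡m u<2))
      (trans (+-distrib-/-∣ʳ u (divides-refl q)) (cong₂ _+_ (m<n⇒m/n≡0 u<2) (m*n/n≡m q 2)))
    children : ∀ q → ∑[ u < 2 ] g (run v (suc k) (u + q * 2)) ≡ transfer g (run v k q)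
    children q = cong₂ _+_ (cong g (last-bit 0 q z<s))
                   (trans (+-identityʳ _) (cong g (last-bit 1 q (s<s z<s))))
  Reach : ℕ → ℕ × ℕ → ℕ × ℕ → Set
  Reach k v w = ∃[ n ] n < 2 ^ k × run v k n ≡ w

  Reach-trans : ∀ {j k u v w} → Reach j u v → Reach k v w → Reach (k + j) u w
  Reach-trans {j} {k} {u} (n , n<2^j , refl) (n′ , n′<2^k , refl) =
    n′ + n * 2 ^ k , u+q*2^k<2^[k+j] k j n′<2^k n<2^j , runBits-concat step u k j n n′ n′<2^k

  Reach-step : ∀ {e} v → e < 2 → Reach 1 v (step e v)
  Reach-step {e} v e<2 = e , e<2 , cong (λ e′ → step e′ v) (m<n⇒m%n≡m e<2)

  Reach≤ : ℕ → ℕ × ℕ → ℕ × ℕ → Set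
  Reach≤ B v w = ∃[ k ] k ≤ B × Reach k v w

  Reach≤-refl : ∀ {B} v → Reach≤ B v v
  Reach≤-refl v = 0 , z≤n , 0 , z<s , refl

  Reach≤-trans : ∀ {B C u v w} → Reach≤ B u v → Reach≤ C v w → Reach≤ (B + C) u w
  Reach≤-trans {B} {C} (j , j≤B , r) (k , k≤C , r′) =
    k + j , subst (k + j ≤_) (+-comm C B) (+-mono-≤ k≤C j≤B) , Reach-trans {j} {k} r r′

  Reach≤-mono : ∀ {B C v w} → B ≤ C → Reach≤ B v w → Reach≤ C v w
  Reach≤-mono B≤C (k , k≤B , r) = k , ≤-trans k≤B B≤C , r

  Reach≤-primitive : ∀ {B v w} → Reach≤ B v w → Primitive v → Primitive w
  Reach≤-primitive {v = v} (k , _ , n , _ , refl) = run-primitive v k n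

  Reach≤-iterate : ∀ {e} → e < 2 → ∀ t v → Reach≤ t v (iterate (step e) t v)
  Reach≤-iterate e<2 zero    v = Reach≤-refl v
  Reach≤-iterate e<2 (suc t) v = Reach≤-trans (1 , ≤-refl , Reach-step v e<2) (Reach≤-iterate e<2 t _)

  iterate-step₀ : ∀ t {a b} → a < d → b < d → iterate (step 0) t (a , b) ≡ (a , (b + t * a) % d)
  iterate-step₀ zero    {a} {b} a<d b<d = cong (a ,_) (sym (trans (cong (_% d) (+-identityʳ b)) (m<n⇒m%n≡m b<d)))
  iterate-step₀ (suc t) {a} {b} a<d b<d = begin
    iterate (step 0) t (a % d , (a + b) % d)  ≡⟨ cong (λ x → iterate (step 0) t (x , (a + b) % d)) (m<n⇒m%n≡m a<d) ⟩
    iterate (step 0) t (a , (a + b) % d)      ≡⟨ iterate-step₀ t a<d (m%n<n (a + b) d) ⟩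
    (a , ((a + b) % d + t * a) % d)           ≡⟨ cong (a ,_) (trans (%-absorbˡ-+ (a + b) (t * a)) (cong (_% d) (solve 3 (λ a b t → a :+ b :+ t :* a := b :+ (a :+ t :* a)) refl a b t))) ⟩
    (a , (b + suc t * a) % d)                 ∎
    where
    open ≡-Reasoning
    open +-*-Solver

  iterate-step₁ : ∀ t {a b} → a < d → b < d → iterate (step 1) t (a , b) ≡ ((a + t * b) % d , b)
  iterate-step₁ zero    {a} {b} a<d b<d = cong (_, b) (sym (trans (cong (_% d) (+-identityʳ a)) (m<n⇒m%n≡m a<d)))
  iterate-step₁ (suc t) {a} {b} a<d b<d = begin
    iterate (step 1) t ((a + b) % d , b % d)  ≡⟨ cong (λ x → iterate (step 1) t ((a + b) % d , x)) (m<n⇒m%n≡m b<d) ⟩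
    iterate (step 1) t ((a + b) % d , b)      ≡⟨ iterate-step₁ t (m%n<n (a + b) d) b<d ⟩
    (((a + b) % d + t * b) % d , b)           ≡⟨ cong (_, b) (trans (%-absorbˡ-+ (a + b) (t * b)) (cong (_% d) (+-assoc a b (t * b)))) ⟩
    ((a + suc t * b) % d , b)                 ∎
    where open ≡-Reasoning

  suc[d∸1]≡d : suc (d ∸ 1) ≡ d
  suc[d∸1]≡d = m+[n∸m]≡n (<-trans z<s 1<d)

  [y+[d∸1]*x]%d : ∀ {x y} → x ≤ y → (y + (d ∸ 1) * x) % d ≡ (y ∸ x) % d
  [y+[d∸1]*x]%d {x} {y} x≤y = begin
    (y + (d ∸ 1) * x) % d          ≡⟨ cong (λ z → (z + (d ∸ 1) * x) % d) (m∸n+n≡m x≤y) ⟨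
    (y ∸ x + x + (d ∸ 1) * x) % d  ≡⟨ cong (_% d) (+-assoc (y ∸ x) x _) ⟩
    (y ∸ x + suc (d ∸ 1) * x) % d  ≡⟨ cong (λ c → (y ∸ x + c * x) % d) suc[d∸1]≡d ⟩
    (y ∸ x + d * x) % d            ≡⟨ cong (λ z → (y ∸ x + z) % d) (*-comm d x) ⟩
    (y ∸ x + x * d) % d            ≡⟨ [m+kn]%n≡m%n (y ∸ x) x d ⟩
    (y ∸ x) % d                    ∎
    where open ≡-Reasoning

  Reach-subtract₀ : ∀ {a b} → a ≤ b → b < d → Reach≤ (d ∸ 1) (a , b) (a , b ∸ a)
  Reach-subtract₀ {a} {b} a≤b b<d =
    subst (Reach≤ (d ∸ 1) (a , b))
          (trans (iterate-step₀ (d ∸ 1) (≤-<-trans a≤b b<d) b<d) (cong (a ,_) (trans ([y+[d∸1]*x]%d a≤b) (m<n⇒m%n≡m (≤-<-trans (m∸n≤m b a) b<d)))))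
          (Reach≤-iterate z<s (d ∸ 1) (a , b))

  Reach-subtract₁ : ∀ {a b} → b ≤ a → a < d → Reach≤ (d ∸ 1) (a , b) (a ∸ b , b)
  Reach-subtract₁ {a} {b} b≤a a<d =
    subst (Reach≤ (d ∸ 1) (a , b))
          (trans (iterate-step₁ (d ∸ 1) a<d (≤-<-trans b≤a a<d)) (cong (_, b) (trans ([y+[d∸1]*x]%d b≤a) (m<n⇒m%n≡m (≤-<-trans (m∸n≤m a b) a<d)))))
          (Reach≤-iterate (s<s z<s) (d ∸ 1) (a , b))

  Reach-axis : ∀ s a b → a < d → b < d → a + b ≤ s →
               ∃[ g ] g ∣ a × g ∣ b × Reach≤ (s * d) (a , b) (0 , g)
  Reach-axis s zero b _ _ _ = b , (b ∣0) , ∣-refl , Reach≤-refl _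
  Reach-axis (suc s) (suc a) zero a<d _ _ = suc a , ∣-refl , (suc a ∣0) , Reach≤-mono (≤-trans (≤-reflexive suc[d∸1]≡d) (m≤m+n d (s * d))) path
    where
    diagonal : step 0 (suc a , 0) ≡ (suc a , suc a)
    diagonal = cong₂ _,_ (m<n⇒m%n≡m a<d) (trans (cong (_% d) (+-identityʳ (suc a))) (m<n⇒m%n≡m a<d))
    path : Reach≤ (1 + (d ∸ 1)) (suc a , 0) (0 , suc a)
    path = Reach≤-trans (1 , ≤-refl , subst (Reach 1 _) diagonal (Reach-step _ z<s))
                        (subst (λ x → Reach≤ (d ∸ 1) (suc a , suc a) (x , suc a)) (n∸n≡0 (suc a)) (Reach-subtract₁ ≤-refl a<d))
  Reach-axis (suc s) (suc a) (suc b) a<d b<d a+b≤s with suc a ≤? suc b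
  ... | yes a≤b =
    let g , g∣a , g∣b∸a , r = Reach-axis s (suc a) (suc b ∸ suc a) a<d (≤-<-trans (m∸n≤m (suc b) (suc a)) b<d) sum≤s
    in g , g∣a , ∣m∸n∣n⇒∣m g a≤b g∣b∸a g∣a , Reach≤-mono d∸1+s*d≤ (Reach≤-trans (Reach-subtract₀ a≤b b<d) r)
    where
    sum≤s : suc a + (suc b ∸ suc a) ≤ s
    sum≤s = subst (_≤ s) (sym (m+[n∸m]≡n a≤b)) (≤-trans (m≤n+m (suc b) a) (≤-pred a+b≤s))
    d∸1+s*d≤ : d ∸ 1 + s * d ≤ suc s * d
    d∸1+s*d≤ = +-monoˡ-≤ (s * d) (m∸n≤m d 1)
  ... | no a≰b =
    let b≤a = <⇒≤ (≰⇒> a≰b)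
        g , g∣a∸b , g∣b , r = Reach-axis s (suc a ∸ suc b) (suc b) (≤-<-trans (m∸n≤m (suc a) (suc b)) a<d) b<d (sum≤s b≤a)
    in g , ∣m∸n∣n⇒∣m g b≤a g∣a∸b g∣b , g∣b , Reach≤-mono d∸1+s*d≤ (Reach≤-trans (Reach-subtract₁ b≤a a<d) r)
    where
    sum≤s : suc b ≤ suc a → suc a ∸ suc b + suc b ≤ s
    sum≤s b≤a = subst (_≤ s) (sym (m∸n+n≡m b≤a)) (≤-trans (subst (suc a ≤_) (sym (+-suc a b)) (s≤s (m≤m+n a b))) (≤-pred a+b≤s))
    d∸1+s*d≤ : d ∸ 1 + s * d ≤ suc s * d
    d∸1+s*d≤ = +-monoˡ-≤ (s * d) (m∸n≤m d 1)

  origin : ℕ × ℕ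
  origin = (0 , 1)

  run-origin : ∀ k → run origin k 0 ≡ origin
  run-origin zero    = refl
  run-origin (suc k) = trans (cong (step 0) (run-origin k)) (cong₂ _,_ (m<n⇒m%n≡m (<-trans z<s 1<d)) (m<n⇒m%n≡m 1<d))

  divisor-of-d-and-unit≡1 : ∀ {x g} → x ∣ d → x ∣ g → NoCommonPrime primes 0 g → x ≡ 1
  divisor-of-d-and-unit≡1 {zero}        0∣d _   _   = contradiction (0∣⇒≡0 0∣d) (≢-nonZero⁻¹ d)
  divisor-of-d-and-unit≡1 {suc zero}    _   _   _   = refl
  divisor-of-d-and-unit≡1 {suc (suc x)} x∣d x∣g ncp =
    let p , p-prime , p∣x = ∃-prime-divisor {suc (suc x)} (s<s z<s)
    in ⊥-elim (All.lookup ncp (∈-primeDivisors⁺ p-prime (∣-trans p∣x x∣d)) (p ∣0 , ∣-trans p∣x x∣g))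

  reachBound : ℕ
  reachBound = 2 * d * d + d + 2 * d * d

  -- Euclid's algorithm runs inside the automaton: subtract down to an axis point (0 , g), move to
  -- (d ∸ g , g), and subtract again; the second gcd divides d and g, so it is 1.
  Reach≤-origin : ∀ v → Primitive v → Reach≤ reachBound v origin
  Reach≤-origin (a , b) pv@(a<d , b<d , _) =
    Reach≤-trans (Reach≤-trans to-axis to-antidiagonal) (subst (λ x → Reach≤ (2 * d * d) (d ∸ g , g) (0 , x)) g′≡1 to-origin)
    where
    sum≤2d : ∀ {x y} → x < d → y < d → x + y ≤ 2 * d
    sum≤2d {x} {y} x<d y<d = subst (x + y ≤_) (cong (d +_) (sym (+-identityʳ d))) (+-mono-≤ (<⇒≤ x<d) (<⇒≤ y<d))
    axis = Reach-axis (2 * d) a b a<d b<d (sum≤2d a<d b<d)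
    g = proj₁ axis
    to-axis : Reach≤ (2 * d * d) (a , b) (0 , g)
    to-axis = proj₂ (proj₂ (proj₂ axis))
    pg : Primitive (0 , g)
    pg = Reach≤-primitive to-axis pv
    g<d = proj₁ (proj₂ pg)
    g≢0 : g ≢ 0
    g≢0 g≡0 = <⇒≢ 1<d (sym (divisor-of-d-and-unit≡1 ∣-refl (subst (d ∣_) (sym g≡0) (d ∣0)) (proj₂ (proj₂ pg))))
    d∸g<d : d ∸ g < d
    d∸g<d = ∸-monoʳ-< (n≢0⇒n>0 g≢0) (<⇒≤ g<d)
    antidiagonal : iterate (step 1) (d ∸ 1) (0 , g) ≡ (d ∸ g , g)
    antidiagonal = begin
      iterate (step 1) (d ∸ 1) (0 , g)  ≡⟨ iterate-step₁ (d ∸ 1) (<-trans z<s 1<d) g<d ⟩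
      ((d ∸ 1) * g % d , g)             ≡⟨ cong (_, g) (sym ([m+n]%n≡m%n ((d ∸ 1) * g) d)) ⟩
      (((d ∸ 1) * g + d) % d , g)       ≡⟨ cong (λ x → (x % d , g)) (+-comm _ d) ⟩
      ((d + (d ∸ 1) * g) % d , g)       ≡⟨ cong (_, g) (trans ([y+[d∸1]*x]%d (<⇒≤ g<d)) (m<n⇒m%n≡m d∸g<d)) ⟩
      (d ∸ g , g)                       ∎
      where open ≡-Reasoning
    to-antidiagonal : Reach≤ d (0 , g) (d ∸ g , g)
    to-antidiagonal = Reach≤-mono (m∸n≤m d 1) (subst (Reach≤ (d ∸ 1) (0 , g)) antidiagonal (Reach≤-iterate (s<s z<s) (d ∸ 1) (0 , g)))
    axis′ = Reach-axis (2 * d) (d ∸ g) g d∸g<d g<d (sum≤2d d∸g<d g<d)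
    g′ = proj₁ axis′
    to-origin : Reach≤ (2 * d * d) (d ∸ g , g) (0 , g′)
    to-origin = proj₂ (proj₂ (proj₂ axis′))
    g′≡1 : g′ ≡ 1
    g′≡1 = divisor-of-d-and-unit≡1 (∣m∸n∣n⇒∣m g′ (<⇒≤ g<d) (proj₁ (proj₂ axis′)) (proj₁ (proj₂ (proj₂ axis′)))) (proj₁ (proj₂ (proj₂ axis′))) (proj₂ (proj₂ pg))

  Reach-origin : ∀ v → Primitive v → Reach reachBound v origin
  Reach-origin v pv =
    let k , k≤B , r = Reach≤-origin v pv
    in subst (λ t → Reach t v origin) (m∸n+n≡m k≤B)
             (Reach-trans {k} {reachBound ∸ k} r (0 , m^n>0 2 (reachBound ∸ k) , run-origin (reachBound ∸ k)))

  W : ℕ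
  W = 2 ^ reachBound ∸ 1

  2^reachBound≡1+W : 2 ^ reachBound ≡ suc W
  2^reachBound≡1+W = sym (m+[n∸m]≡n (m^n>0 2 reachBound))

  -- From every primitive state one of the 2 ^ reachBound paths of length reachBound ends at origin: that
  -- path contributes the same value to every state, and only the remaining W paths spread the values apart.
  bounded-oscillation : ∀ (f : ℕ × ℕ → ℕ) → (∀ v → f v ≤ 1) → ∀ j → ∃[ lo ] ∃[ hi ] hi ≤ lo + W ^ j ×
    (∀ v → Primitive v → lo ≤ iterate transfer (j * reachBound) f v × iterate transfer (j * reachBound) f v ≤ hi)
  bounded-oscillation f f≤1 zero = 0 , 1 , ≤-refl , λ v _ → z≤n , f≤1 v
  bounded-oscillation f f≤1 (suc j) =
    let lo , hi , hi≤lo+W^j , bounds = bounded-oscillation f f≤1 j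
    in h origin + W * lo , h origin + W * hi , width hi≤lo+W^j , next-bounds bounds
    where
    h = iterate transfer (j * reachBound) f
    width : ∀ {lo hi c} → hi ≤ lo + W ^ j → c + W * hi ≤ c + W * lo + W ^ suc j
    width {lo} {hi} {c} hi≤ = begin
      c + W * hi              ≤⟨ +-monoʳ-≤ c (*-monoʳ-≤ W hi≤) ⟩
      c + W * (lo + W ^ j)    ≡⟨ solve 4 (λ c w l p → c :+ w :* (l :+ p) := c :+ w :* l :+ w :* p) refl c W lo (W ^ j) ⟩
      c + W * lo + W ^ suc j  ∎
      where
      open ≤-Reasoning
      open +-*-Solver
    unfold : ∀ v → iterate transfer (suc j * reachBound) f v ≡ ∑[ n < suc W ] h (run v reachBound n)
    unfold v = begin
      iterate transfer (reachBound + j * reachBound) f v  ≡⟨ cong (λ k → iterate transfer k f v) (+-comm reachBound (j * reachBound)) ⟩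
      iterate transfer (j * reachBound + reachBound) f v  ≡⟨ cong-app (iterate-+ transfer (j * reachBound) reachBound f) v ⟩
      iterate transfer reachBound h v                     ≡⟨ ∑-run≡transfer reachBound h v ⟨
      ∑[ n < 2 ^ reachBound ] h (run v reachBound n)      ≡⟨ cong (λ B → ∑< B (h ∘ run v reachBound)) 2^reachBound≡1+W ⟩
      ∑[ n < suc W ] h (run v reachBound n)               ∎
      where open ≡-Reasoning
    next-bounds : ∀ {lo hi} → (∀ v → Primitive v → lo ≤ h v × h v ≤ hi) → ∀ v → Primitive v →
      h origin + W * lo ≤ iterate transfer (suc j * reachBound) f v × iterate transfer (suc j * reachBound) f v ≤ h origin + W * hi
    next-bounds {lo} {hi} bounds v pv =
      subst (h origin + W * lo ≤_) (sym (unfold v)) (c+n*lo≤∑ W _ n<1+W (cong h reaches) (λ x _ → proj₁ (child x))) ,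
      subst (_≤ h origin + W * hi) (sym (unfold v)) (∑≤c+n*hi W _ n<1+W (cong h reaches) (λ x _ → proj₂ (child x)))
      where
      n : ℕ
      n = proj₁ (Reach-origin v pv)
      n<1+W : n < suc W
      n<1+W = subst (n <_) 2^reachBound≡1+W (proj₁ (proj₂ (Reach-origin v pv)))
      reaches : run v reachBound n ≡ origin
      reaches = proj₂ (proj₂ (Reach-origin v pv))
      child : ∀ x → lo ≤ h (run v reachBound x) × h (run v reachBound x) ≤ hi
      child x = bounds _ (run-primitive v reachBound x pv)

  ∑Primitive : (ℕ × ℕ → ℕ) → ℕ
  ∑Primitive g = ∑[ a < d ] ∑[ b < d ] (χ primes a b * g (a , b))

  χ-shear₀ : ∀ a b → χ primes a b ≡ χ primes a ((a + b) % d)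
  χ-shear₀ a b = cong 𝟙 (does-⇔ (mk⇔ (noCommonPrime-map to) (noCommonPrime-map from)) (noCommonPrime? _ a b) (noCommonPrime? _ a ((a + b) % d)))
    where
    to : ∀ {p} → p ∈ primes → p ∣ a × p ∣ (a + b) % d → p ∣ a × p ∣ b
    to p∈ (p∣a , p∣a+b) = p∣a , ∣m+n∣m⇒∣n (∣%⇒∣ p∈ p∣a+b) p∣a
    from : ∀ {p} → p ∈ primes → p ∣ a × p ∣ b → p ∣ a × p ∣ (a + b) % d
    from p∈ (p∣a , p∣b) = p∣a , ∣⇒∣% p∈ (∣m∣n⇒∣m+n p∣a p∣b)

  χ-shear₁ : ∀ a b → χ primes a b ≡ χ primes ((b + a) % d) b
  χ-shear₁ a b = cong 𝟙 (does-⇔ (mk⇔ (noCommonPrime-map to) (noCommonPrime-map from)) (noCommonPrime? _ a b) (noCommonPrime? _ ((b + a) % d) b))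
    where
    to : ∀ {p} → p ∈ primes → p ∣ (b + a) % d × p ∣ b → p ∣ a × p ∣ b
    to p∈ (p∣b+a , p∣b) = ∣m+n∣m⇒∣n (∣%⇒∣ p∈ p∣b+a) p∣b , p∣b
    from : ∀ {p} → p ∈ primes → p ∣ a × p ∣ b → p ∣ (b + a) % d × p ∣ b
    from p∈ (p∣a , p∣b) = ∣⇒∣% p∈ (∣m∣n⇒∣m+n p∣b p∣a) , p∣b

  -- The steps act on primitive residue pairs as the shears (a , b) ↦ (a , a + b) and (a , b) ↦ (a + b , b),
  -- which are bijections: the counting measure on primitive states is invariant.
  ∑Primitive-step₀ : ∀ g → ∑Primitive (g ∘ step 0) ≡ ∑Primitive g
  ∑Primitive-step₀ g = ∑-cong d λ a a<d → begin
    ∑[ b < d ] (χ primes a b * g (a % d , (a + b) % d))          ≡⟨ ∑-cong d (λ b _ → cong₂ (λ x y → x * g (y , (a + b) % d)) (χ-shear₀ a b) (m<n⇒m%n≡m a<d)) ⟩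
    ∑[ b < d ] (χ primes a ((a + b) % d) * g (a , (a + b) % d))  ≡⟨ ∑-rotate d a (λ c → χ primes a c * g (a , c)) ⟩
    ∑[ c < d ] (χ primes a c * g (a , c))                        ∎
    where open ≡-Reasoning

  ∑Primitive-step₁ : ∀ g → ∑Primitive (g ∘ step 1) ≡ ∑Primitive g
  ∑Primitive-step₁ g = begin
    ∑[ a < d ] ∑[ b < d ] (χ primes a b * g ((a + b) % d , b % d))  ≡⟨ ∑-comm d d _ ⟩
    ∑[ b < d ] ∑[ a < d ] (χ primes a b * g ((a + b) % d , b % d))  ≡⟨ ∑-cong d (λ b b<d → trans (∑-cong d (λ a _ → column b b<d a)) (∑-rotate d b (λ c → χ primes c b * g (c , b)))) ⟩
    ∑[ b < d ] ∑[ c < d ] (χ primes c b * g (c , b))                ≡⟨ ∑-comm d d _ ⟨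
    ∑Primitive g                                                    ∎
    where
    open ≡-Reasoning
    column : ∀ b → b < d → ∀ a → χ primes a b * g ((a + b) % d , b % d) ≡ χ primes ((b + a) % d) b * g ((b + a) % d , b)
    column b b<d a = cong₂ (λ x y → x * g y) (χ-shear₁ a b) (cong₂ _,_ (cong (_% d) (+-comm a b)) (m<n⇒m%n≡m b<d))

  ∑Primitive-+ : ∀ g h → ∑Primitive (λ v → g v + h v) ≡ ∑Primitive g + ∑Primitive h
  ∑Primitive-+ g h = begin
    ∑[ a < d ] ∑[ b < d ] (χ primes a b * (g (a , b) + h (a , b)))                          ≡⟨ ∑-cong d (λ a _ → ∑-cong d (λ b _ → *-distribˡ-+ (χ primes a b) _ _)) ⟩
    ∑[ a < d ] ∑[ b < d ] (χ primes a b * g (a , b) + χ primes a b * h (a , b))                    ≡⟨ ∑-cong d (λ a _ → ∑-distrib-+ d _ _) ⟩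
    ∑[ a < d ] (∑[ b < d ] (χ primes a b * g (a , b)) + ∑[ b < d ] (χ primes a b * h (a , b)))     ≡⟨ ∑-distrib-+ d _ _ ⟩
    ∑Primitive g + ∑Primitive h                                                      ∎
    where open ≡-Reasoning

  ∑Primitive-transfer : ∀ k g → ∑Primitive (iterate transfer k g) ≡ 2 ^ k * ∑Primitive g
  ∑Primitive-transfer zero    g = sym (*-identityˡ (∑Primitive g))
  ∑Primitive-transfer (suc k) g = begin
    ∑Primitive (iterate transfer k (transfer g))                 ≡⟨ ∑Primitive-transfer k (transfer g) ⟩
    2 ^ k * ∑Primitive (transfer g)                              ≡⟨ cong (2 ^ k *_) (∑Primitive-+ (g ∘ step 0) (g ∘ step 1)) ⟩
    2 ^ k * (∑Primitive (g ∘ step 0) + ∑Primitive (g ∘ step 1))  ≡⟨ cong (2 ^ k *_) (cong₂ _+_ (∑Primitive-step₀ g) (∑Primitive-step₁ g)) ⟩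
    2 ^ k * (∑Primitive g + ∑Primitive g)                        ≡⟨ solve 2 (λ p s → p :* (s :+ s) := con 2 :* p :* s) refl (2 ^ k) (∑Primitive g) ⟩
    2 ^ suc k * ∑Primitive g                                     ∎
    where
    open ≡-Reasoning
    open +-*-Solver

  ∑Primitive-mono-≤ : ∀ {g h} → (∀ v → Primitive v → g v ≤ h v) → ∑Primitive g ≤ ∑Primitive h
  ∑Primitive-mono-≤ {g} {h} g≤h = ∑-mono-≤ d (λ a a<d → ∑-mono-≤ d (λ b b<d → weighted a b a<d b<d))
    where
    weighted : ∀ a b → a < d → b < d → χ primes a b * g (a , b) ≤ χ primes a b * h (a , b)
    weighted a b a<d b<d with noCommonPrime? primes a b
    ... | yes ncp = +-monoˡ-≤ 0 (g≤h (a , b) (a<d , b<d , ncp))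
    ... | no  _   = z≤n

  #Primitive : ℕ
  #Primitive = ∑Primitive (λ _ → 1)

  ∑Primitive-const : ∀ c → ∑Primitive (λ _ → c) ≡ c * #Primitive
  ∑Primitive-const c = begin
    ∑[ a < d ] ∑[ b < d ] (χ primes a b * c)        ≡⟨ ∑-cong d (λ a _ → ∑-cong d (λ b _ → trans (*-comm (χ primes a b) c) (cong (c *_) (sym (*-identityʳ (χ primes a b)))))) ⟩
    ∑[ a < d ] ∑[ b < d ] (c * (χ primes a b * 1))  ≡⟨ ∑-cong d (λ a _ → ∑-distribˡ-* d c _) ⟩
    ∑[ a < d ] (c * ∑[ b < d ] (χ primes a b * 1))  ≡⟨ ∑-distribˡ-* d c _ ⟩
    c * #Primitive                                  ∎
    where open ≡-Reasoning

  transfer-near-mean : ∀ f → (∀ v → f v ≤ 1) → ∀ j v → Primitive v →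
    #Primitive * iterate transfer (j * reachBound) f v ≤ 2 ^ (j * reachBound) * ∑Primitive f + #Primitive * W ^ j ×
    2 ^ (j * reachBound) * ∑Primitive f ≤ #Primitive * iterate transfer (j * reachBound) f v + #Primitive * W ^ j
  transfer-near-mean f f≤1 j v pv =
    let lo , hi , hi≤lo+W^j , bounds = bounded-oscillation f f≤1 j
        Z = #Primitive
        h = iterate transfer (j * reachBound) f
        mass = ∑Primitive-transfer (j * reachBound) f
        lo*Z≤mass = subst₂ _≤_ (∑Primitive-const lo) mass (∑Primitive-mono-≤ (λ u pu → proj₁ (bounds u pu)))
        mass≤hi*Z = subst₂ _≤_ mass (∑Primitive-const hi) (∑Primitive-mono-≤ (λ u pu → proj₂ (bounds u pu)))
        lo≤hv , hv≤hi = bounds v pv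
    in (begin
          Z * h v             ≤⟨ *-monoʳ-≤ Z (≤-trans hv≤hi hi≤lo+W^j) ⟩
          Z * (lo + W ^ j)    ≡⟨ *-distribˡ-+ Z lo (W ^ j) ⟩
          Z * lo + Z * W ^ j  ≤⟨ +-monoˡ-≤ (Z * W ^ j) (subst (_≤ 2 ^ (j * reachBound) * ∑Primitive f) (*-comm lo Z) lo*Z≤mass) ⟩
          2 ^ (j * reachBound) * ∑Primitive f + Z * W ^ j   ∎) ,
       (begin
          2 ^ (j * reachBound) * ∑Primitive f  ≤⟨ mass≤hi*Z ⟩
          hi * Z                               ≤⟨ *-monoˡ-≤ Z (≤-trans hi≤lo+W^j (+-monoˡ-≤ (W ^ j) lo≤hv)) ⟩
          (h v + W ^ j) * Z                    ≡⟨ trans (*-comm _ Z) (*-distribˡ-+ Z (h v) (W ^ j)) ⟩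
          Z * h v + Z * W ^ j                  ∎)
    where open ≤-Reasoning

  firstIs : ℕ → ℕ × ℕ → ℕ
  firstIs i (a , b) = 𝟙 (does (a % d ≟ i % d))

  firstIs≤1 : ∀ i v → firstIs i v ≤ 1
  firstIs≤1 i (a , b) = 𝟙≤1 (does (a % d ≟ i % d))

  firstIs-reduce : ∀ i v → firstIs i (reduce v) ≡ firstIs i v
  firstIs-reduce i (a , b) = cong (λ x → 𝟙 (does (x ≟ i % d))) (m%n%n≡m%n a d)

  T≡∑firstIs : ∀ N i → T N d i ≡ ∑[ n < N ] firstIs i (stern₂ n)
  T≡∑firstIs N i = length-filter-applyUpTo (λ n → stern n % d ≟ i % d) id N

  blockCount : ℕ → ℕ → ℕ → ℕ
  blockCount i k q = iterate transfer k (firstIs i) (reduce (stern₂ q))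

  ∑-block≡blockCount : ∀ i k q → ∑[ u < 2 ^ k ] firstIs i (stern₂ (u + q * 2 ^ k)) ≡ blockCount i k q
  ∑-block≡blockCount i k q = trans (∑-cong (2 ^ k) along-run) (∑-run≡transfer k (firstIs i) (reduce (stern₂ q)))
    where
    along-run : ∀ u → u < 2 ^ k → firstIs i (stern₂ (u + q * 2 ^ k)) ≡ firstIs i (run (reduce (stern₂ q)) k u)
    along-run u u<2^k = begin
      firstIs i (stern₂ (u + q * 2 ^ k))            ≡⟨ cong (firstIs i) (stern₂-block k q u u<2^k) ⟩
      firstIs i (runStern (stern₂ q) k u)           ≡⟨ firstIs-reduce i (runStern (stern₂ q) k u) ⟨
      firstIs i (reduce (runStern (stern₂ q) k u))  ≡⟨ cong (firstIs i) (reduce-runStern (stern₂ q) k u) ⟩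
      firstIs i (run (reduce (stern₂ q)) k u)       ∎
      where open ≡-Reasoning

  T-blocks : ∀ i k M R → T (M * 2 ^ k + R) d i ≡ ∑[ q < M ] blockCount i k q + ∑[ x < R ] firstIs i (stern₂ (M * 2 ^ k + x))
  T-blocks i k M R = begin
    T (M * B + R) d i                                            ≡⟨ T≡∑firstIs (M * B + R) i ⟩
    ∑[ n < M * B + R ] firstIs i (stern₂ n)                      ≡⟨ ∑-split (M * B) R _ ⟩
    ∑[ n < M * B ] firstIs i (stern₂ n) + rest                   ≡⟨ cong (_+ rest) (∑-blocks M B _) ⟩
    ∑[ q < M ] ∑[ u < B ] firstIs i (stern₂ (u + q * B)) + rest  ≡⟨ cong (_+ rest) (∑-cong M (λ q _ → ∑-block≡blockCount i k q)) ⟩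
    ∑[ q < M ] blockCount i k q + rest                           ∎
    where
    open ≡-Reasoning
    B = 2 ^ k
    rest = ∑[ x < R ] firstIs i (stern₂ (M * B + x))

  ∑-blockCount-near-mean : ∀ i j M →
    let Z = #Primitive; B = 2 ^ (j * reachBound); F = ∑Primitive (firstIs i); S = ∑[ q < M ] blockCount i (j * reachBound) q in
    Z * S ≤ M * (B * F) + M * (Z * W ^ j) × M * (B * F) ≤ Z * S + M * (Z * W ^ j)
  ∑-blockCount-near-mean i j M = Z*S≤ , M*B*F≤
    where
    open ≤-Reasoning
    Z = #Primitive
    B = 2 ^ (j * reachBound)
    F = ∑Primitive (firstIs i)
    w = W ^ j
    h = blockCount i (j * reachBound)
    near : ∀ q → Z * h q ≤ B * F + Z * w × B * F ≤ Z * h q + Z * w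
    near q = transfer-near-mean (firstIs i) (firstIs≤1 i) j (reduce (stern₂ q)) (reduce-coprime _ (stern₂-coprime q))
    Z*S≤ : Z * ∑< M h ≤ M * (B * F) + M * (Z * w)
    Z*S≤ = begin
      Z * ∑< M h                  ≡⟨ ∑-distribˡ-* M Z h ⟨
      ∑[ q < M ] (Z * h q)        ≤⟨ ∑-mono-≤ M (λ q _ → proj₁ (near q)) ⟩
      ∑[ q < M ] (B * F + Z * w)  ≡⟨ ∑-const M _ ⟩
      M * (B * F + Z * w)         ≡⟨ *-distribˡ-+ M _ _ ⟩
      M * (B * F) + M * (Z * w)   ∎
    M*B*F≤ : M * (B * F) ≤ Z * ∑< M h + M * (Z * w)
    M*B*F≤ = begin
      M * (B * F)                                ≡⟨ ∑-const M _ ⟨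
      ∑[ q < M ] (B * F)                         ≤⟨ ∑-mono-≤ M (λ q _ → proj₂ (near q)) ⟩
      ∑[ q < M ] (Z * h q + Z * w)               ≡⟨ ∑-distrib-+ M _ _ ⟩
      ∑[ q < M ] (Z * h q) + ∑[ q < M ] (Z * w)  ≡⟨ cong₂ _+_ (∑-distribˡ-* M Z h) (∑-const M _) ⟩
      Z * ∑< M h + M * (Z * w)                   ∎

  -- An error of W ^ j for each of the N / B complete blocks of length B, plus the incomplete block.
  blockError : ℕ → ℕ → ℕ
  blockError j N = N / B * W ^ j + N % B
    where
    B = 2 ^ (j * reachBound)
    instance
      B≢0 : NonZero B
      B≢0 = m^n≢0 2 (j * reachBound)

  discrepancy : ∀ i j N →
    #Primitive * T N d i ≤ ∑Primitive (firstIs i) * N + #Primitive * blockError j N ×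
    ∑Primitive (firstIs i) * N ≤ #Primitive * T N d i + #Primitive * blockError j N
  discrepancy i j N = upper , lower
    where
    open ≤-Reasoning
    open +-*-Solver
    B = 2 ^ (j * reachBound)
    instance
      B≢0 : NonZero B
      B≢0 = m^n≢0 2 (j * reachBound)
    M = N / B
    R = N % B
    Z = #Primitive
    F = ∑Primitive (firstIs i)
    w = W ^ j
    S = ∑[ q < M ] blockCount i (j * reachBound) q
    rest = ∑[ x < R ] firstIs i (stern₂ (M * B + x))
    N≡MB+R : N ≡ M * B + R
    N≡MB+R = trans (m≡m%n+[m/n]*n N B) (+-comm R (M * B))
    T≡S+rest : T N d i ≡ S + rest
    T≡S+rest = trans (cong (λ n → T n d i) N≡MB+R) (T-blocks i (j * reachBound) M R)
    rest≤R : rest ≤ R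
    rest≤R = subst (rest ≤_) (trans (∑-const R 1) (*-identityʳ R)) (∑-mono-≤ R (λ x _ → firstIs≤1 i (stern₂ (M * B + x))))
    F≤Z : F ≤ Z
    F≤Z = ∑Primitive-mono-≤ (λ v _ → firstIs≤1 i v)
    upper : Z * T N d i ≤ F * N + Z * blockError j N
    upper = begin
      Z * T N d i                                ≡⟨ trans (cong (Z *_) T≡S+rest) (*-distribˡ-+ Z S rest) ⟩
      Z * S + Z * rest                           ≤⟨ +-mono-≤ (proj₁ (∑-blockCount-near-mean i j M)) (*-monoʳ-≤ Z rest≤R) ⟩
      M * (B * F) + M * (Z * w) + Z * R          ≤⟨ m≤m+n _ (F * R) ⟩
      M * (B * F) + M * (Z * w) + Z * R + F * R  ≡⟨ solve 6 (λ M B F Z w R → M :* (B :* F) :+ M :* (Z :* w) :+ Z :* R :+ F :* R := F :* (M :* B :+ R) :+ Z :* (M :* w :+ R)) refl M B F Z w R ⟩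
      F * (M * B + R) + Z * (M * w + R)          ≡⟨ cong (λ n → F * n + Z * (M * w + R)) N≡MB+R ⟨
      F * N + Z * blockError j N                 ∎
    lower : F * N ≤ Z * T N d i + Z * blockError j N
    lower = begin
      F * N                                 ≡⟨ cong (F *_) N≡MB+R ⟩
      F * (M * B + R)                       ≡⟨ solve 4 (λ F M B R → F :* (M :* B :+ R) := M :* (B :* F) :+ F :* R) refl F M B R ⟩
      M * (B * F) + F * R                   ≤⟨ +-mono-≤ (proj₂ (∑-blockCount-near-mean i j M)) (*-monoˡ-≤ R F≤Z) ⟩
      Z * S + M * (Z * w) + Z * R           ≤⟨ +-monoˡ-≤ (Z * R) (+-monoˡ-≤ (M * (Z * w)) (*-monoʳ-≤ Z (m≤m+n S rest))) ⟩
      Z * (S + rest) + M * (Z * w) + Z * R  ≡⟨ cong (λ t → Z * t + M * (Z * w) + Z * R) T≡S+rest ⟨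
      Z * T N d i + M * (Z * w) + Z * R     ≡⟨ solve 5 (λ Z t M w R → Z :* t :+ M :* (Z :* w) :+ Z :* R := Z :* t :+ Z :* (M :* w :+ R)) refl Z (T N d i) M w R ⟩
      Z * T N d i + Z * blockError j N      ∎

-- Density of primitive pairs

[_∣_] : ℕ → ℕ → ℕ
[ p ∣ x ] = 𝟙 (does (p ∣? x))

χ-∷ : ∀ p ps a b → χ ps a b ≡ χ (p ∷ ps) a b + [ p ∣ a ] * ([ p ∣ b ] * χ ps a b)
χ-∷ p ps a b with does (p ∣? a) | does (p ∣? b) | does (noCommonPrime? ps a b)
... | true  | true  | true  = refl
... | true  | true  | false = refl
... | true  | false | true  = refl
... | true  | false | false = refl
... | false | true  | true  = refl
... | false | true  | false = refl
... | false | false | true  = refl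
... | false | false | false = refl

DivisibilityInvariant : List ℕ → (ℕ → ℕ) → Set
DivisibilityInvariant ps h = ∀ x y → All (λ q → q ∣ x ⇔ q ∣ y) ps → h x ≡ h y

noCommonPrime-mapʳ : ∀ {ps a x y} → (∀ {q} → q ∈ ps → q ∣ y → q ∣ x) → NoCommonPrime ps a x → NoCommonPrime ps a y
noCommonPrime-mapʳ f = noCommonPrime-map (λ q∈ (q∣a , q∣y) → q∣a , f q∈ q∣y)

noCommonPrime-mapˡ : ∀ {ps b x y} → (∀ {q} → q ∈ ps → q ∣ y → q ∣ x) → NoCommonPrime ps x b → NoCommonPrime ps y b
noCommonPrime-mapˡ f = noCommonPrime-map (λ q∈ (q∣y , q∣b) → f q∈ q∣y , q∣b)

χ-invariantʳ : ∀ ps a → DivisibilityInvariant ps (χ ps a)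
χ-invariantʳ ps a x y x~y = cong 𝟙 (does-⇔ (mk⇔ (noCommonPrime-mapʳ (λ q∈ → Equivalence.from (All.lookup x~y q∈)))
                                                   (noCommonPrime-mapʳ (λ q∈ → Equivalence.to (All.lookup x~y q∈))))
                                              (noCommonPrime? ps a x) (noCommonPrime? ps a y))

χ-invariantˡ : ∀ ps b → DivisibilityInvariant ps (λ a → χ ps a b)
χ-invariantˡ ps b x y x~y = cong 𝟙 (does-⇔ (mk⇔ (noCommonPrime-mapˡ (λ q∈ → Equivalence.from (All.lookup x~y q∈)))
                                                   (noCommonPrime-mapˡ (λ q∈ → Equivalence.to (All.lookup x~y q∈))))
                                              (noCommonPrime? ps x b) (noCommonPrime? ps y b))

numerator denominator : ℕ → ℕ → ℕ
numerator   p i = if does (p ∣? i) then p     else p * p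
denominator p i = if does (p ∣? i) then suc p else suc (p * p ∸ 2)

0<∏denominator : ∀ i ps → 0 < product (map (λ p → denominator p i) ps)
0<∏denominator i []       = z<s
0<∏denominator i (p ∷ ps) = *-mono-≤ 0<denominator (0<∏denominator i ps)
  where
  0<denominator : 0 < denominator p i
  0<denominator with does (p ∣? i)
  ... | true  = z<s
  ... | false = z<s

density-step-∣ : ∀ p {n z z′ f f′ d D} .{{_ : NonZero p}} → n * z ≡ f * d * D →
                 p * p * z′ + z ≡ p * p * z → p * f′ + f ≡ p * f → p * n * z′ ≡ f′ * d * (suc p * D)
density-step-∣ p {n} {z} {z′} {f} {f′} {d} {D} nz≡fdD z-step f-step =
  *-cancelˡ-≡ _ _ p (+-cancelʳ-≡ (suc p * X) _ _ (begin
    p * (p * n * z′) + suc p * X            ≡⟨ solve 4 (λ p n z x → p :* (p :* n :* z) :+ (con 1 :+ p) :* x := n :* (p :* p :* z) :+ x :+ p :* x) refl p n z′ X ⟩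
    n * (p * p * z′) + X + p * X            ≡⟨ cong (λ y → n * (p * p * z′) + y + p * X) nz≡fdD ⟨
    n * (p * p * z′) + n * z + p * X        ≡⟨ cong (_+ p * X) (trans (sym (*-distribˡ-+ n _ _)) (cong (n *_) z-step)) ⟩
    n * (p * p * z) + p * X                 ≡⟨ cong (_+ p * X) (trans (solve 3 (λ n p z → n :* (p :* p :* z) := p :* p :* (n :* z)) refl n p z) (cong (p * p *_) nz≡fdD)) ⟩
    p * p * X + p * X                       ≡⟨ solve 4 (λ p f d D → p :* p :* (f :* d :* D) :+ p :* (f :* d :* D) := p :* f :* d :* ((con 1 :+ p) :* D)) refl p f d D ⟩
    p * f * d * (suc p * D)                 ≡⟨ cong (λ y → y * d * (suc p * D)) f-step ⟨
    (p * f′ + f) * d * (suc p * D)          ≡⟨ solve 5 (λ p f′ f d D → (p :* f′ :+ f) :* d :* ((con 1 :+ p) :* D) := p :* (f′ :* d :* ((con 1 :+ p) :* D)) :+ (con 1 :+ p) :* (f :* d :* D)) refl p f′ f d D ⟩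
    p * (f′ * d * (suc p * D)) + suc p * X  ∎))
  where
  open ≡-Reasoning
  open +-*-Solver
  X = f * d * D

density-step-∤ : ∀ p {n z z′ f f′ d D} → 1 < p → n * z ≡ f * d * D →
                 p * p * z′ + z ≡ p * p * z → f′ ≡ f → p * p * n * z′ ≡ f′ * d * (suc (p * p ∸ 2) * D)
density-step-∤ p {n} {z} {z′} {f} {f′} {d} {D} 1<p nz≡fdD z-step refl = +-cancelʳ-≡ X _ _ (begin
  p * p * n * z′ + X                 ≡⟨ cong (p * p * n * z′ +_) nz≡fdD ⟨
  p * p * n * z′ + n * z             ≡⟨ solve 4 (λ p n z′ z → p :* p :* n :* z′ :+ n :* z := n :* (p :* p :* z′ :+ z)) refl p n z′ z ⟩
  n * (p * p * z′ + z)               ≡⟨ cong (n *_) z-step ⟩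
  n * (p * p * z)                    ≡⟨ trans (solve 3 (λ n p z → n :* (p :* p :* z) := p :* p :* (n :* z)) refl n p z) (cong (p * p *_) nz≡fdD) ⟩
  p * p * X                          ≡⟨ cong (_* X) p*p≡suc[p*p∸2]+1 ⟩
  (suc (p * p ∸ 2) + 1) * X          ≡⟨ solve 4 (λ s f d D → (s :+ con 1) :* (f :* d :* D) := f :* d :* (s :* D) :+ f :* d :* D) refl (suc (p * p ∸ 2)) f d D ⟩
  f * d * (suc (p * p ∸ 2) * D) + X  ∎)
  where
  open ≡-Reasoning
  open +-*-Solver
  X = f * d * D
  p*p≡suc[p*p∸2]+1 : p * p ≡ suc (p * p ∸ 2) + 1
  p*p≡suc[p*p∸2]+1 = sym (trans (+-comm (suc (p * p ∸ 2)) 1) (m+[n∸m]≡n (*-mono-≤ 1<p (<⇒≤ 1<p))))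

prime∣prime⇒≡ : ∀ {p q} → Prime p → Prime q → q ∣ p → q ≡ p
prime∣prime⇒≡ p-prime q-prime q∣p with prime⇒irreducible p-prime q∣p
... | inj₁ refl = contradiction q-prime ¬prime[1]
... | inj₂ q≡p  = q≡p

module PrimitiveDensity (d : ℕ) where

  count₁ : List ℕ → ℕ → ℕ
  count₁ ps a = ∑[ b < d ] χ ps a b

  count₂ : List ℕ → ℕ
  count₂ ps = ∑[ a < d ] count₁ ps a

  PrimeDivisorsOfD : List ℕ → Set
  PrimeDivisorsOfD = All (λ q → Prime q × q ∣ d)

  module Sieve {p L} (p-prime : Prime p) (p∣d : p ∣ d) (L-ok : PrimeDivisorsOfD L) (p∉L : All (p ≢_) L) where

    e : ℕ
    e = quotient p∣d

    d≡e*p : d ≡ e * p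
    d≡e*p = _∣_.equality p∣d

    L∣e : All (_∣ e) L
    L∣e = All.zipWith divides-e (L-ok , p∉L)
      where
      divides-e : ∀ {q} → (Prime q × q ∣ d) × p ≢ q → q ∣ e
      divides-e ((q-prime , q∣d) , p≢q) with euclidsLemma e p q-prime (subst (_ ∣_) d≡e*p q∣d)
      ... | inj₁ q∣e = q∣e
      ... | inj₂ q∣p = contradiction (sym (prime∣prime⇒≡ p-prime q-prime q∣p)) p≢q

    -- A divisibility-invariant h is e-periodic and satisfies h (c * p) = h c, so the multiples of p
    -- carry exactly a 1/p share of its sum over [0, d).
    p*∑-multiples≡∑ : ∀ h → DivisibilityInvariant L h → p * ∑[ b < d ] ([ p ∣ b ] * h b) ≡ ∑< d h
    p*∑-multiples≡∑ h h-inv = begin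
      p * ∑[ b < d ] ([ p ∣ b ] * h b)                               ≡⟨ cong (λ n → p * ∑< n (λ b → [ p ∣ b ] * h b)) d≡e*p ⟩
      p * ∑[ b < e * p ] ([ p ∣ b ] * h b)                           ≡⟨ cong (p *_) (∑-blocks e p _) ⟩
      p * ∑[ c < e ] ∑[ t < p ] ([ p ∣ t + c * p ] * h (t + c * p))  ≡⟨ cong (p *_) (∑-cong e (λ c _ → one-multiple-per-block c)) ⟩
      p * ∑< e h                                                     ≡⟨ ∑-const p (∑< e h) ⟨
      ∑[ c < p ] ∑[ u < e ] h u                                      ≡⟨ ∑-cong p (λ c _ → ∑-cong e (λ u _ → periodic c u)) ⟨
      ∑[ c < p ] ∑[ u < e ] h (u + c * e)                            ≡⟨ ∑-blocks p e h ⟨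
      ∑< (p * e) h                                                   ≡⟨ cong (λ n → ∑< n h) (trans (*-comm p e) (sym d≡e*p)) ⟩
      ∑< d h                                                         ∎
      where
      open ≡-Reasoning
      periodic : ∀ c u → h (u + c * e) ≡ h u
      periodic c u = h-inv _ _ (All.map (λ {q} q∣e → mk⇔ (λ q∣u+ce → ∣m+n∣m⇒∣n (subst (q ∣_) (+-comm u (c * e)) q∣u+ce) (∣-trans q∣e (n∣m*n c)))
                                                         (λ q∣u → ∣m∣n⇒∣m+n q∣u (∣-trans q∣e (n∣m*n c)))) L∣e)
      scaled : ∀ c → h (c * p) ≡ h c
      scaled c = h-inv _ _ (All.zipWith (λ { ((q-prime , _) , p≢q) → mk⇔ (q∣cp⇒q∣c q-prime p≢q) (λ q∣c → ∣-trans q∣c (m∣m*n p)) })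
                                        (L-ok , p∉L))
        where
        q∣cp⇒q∣c : ∀ {q} → Prime q → p ≢ q → q ∣ c * p → q ∣ c
        q∣cp⇒q∣c q-prime p≢q q∣cp with euclidsLemma c p q-prime q∣cp
        ... | inj₁ q∣c = q∣c
        ... | inj₂ q∣p = contradiction (sym (prime∣prime⇒≡ p-prime q-prime q∣p)) p≢q
      one-multiple-per-block : ∀ c → ∑[ t < p ] ([ p ∣ t + c * p ] * h (t + c * p)) ≡ h c
      one-multiple-per-block c = begin
        ∑[ t < p ] ([ p ∣ t + c * p ] * h (t + c * p))      ≡⟨ cong (λ n → ∑< n (λ t → [ p ∣ t + c * p ] * h (t + c * p))) (sym suc[p∸1]≡p) ⟩
        [ p ∣ c * p ] * h (c * p) + ∑[ t < p ∸ 1 ] ([ p ∣ suc t + c * p ] * h (suc t + c * p))   ≡⟨ cong₂ _+_ multiple others ⟩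
        h c + (p ∸ 1) * 0                                  ≡⟨ trans (cong (h c +_) (*-zeroʳ (p ∸ 1))) (+-identityʳ (h c)) ⟩
        h c                                                ∎
        where
        suc[p∸1]≡p : suc (p ∸ 1) ≡ p
        suc[p∸1]≡p = m+[n∸m]≡n (>-nonZero⁻¹ p {{prime⇒nonZero p-prime}})
        multiple : [ p ∣ c * p ] * h (c * p) ≡ h c
        multiple = trans (cong (λ b → 𝟙 b * h (c * p)) (dec-true (p ∣? c * p) (n∣m*n c))) (trans (+-identityʳ _) (scaled c))
        others : ∑[ t < p ∸ 1 ] ([ p ∣ suc t + c * p ] * h (suc t + c * p)) ≡ (p ∸ 1) * 0
        others = trans (∑-cong (p ∸ 1) λ t t<p∸1 → cong (λ b → 𝟙 b * h (suc t + c * p)) (dec-false (p ∣? suc t + c * p) (p∤ t t<p∸1)))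
                       (∑-const (p ∸ 1) 0)
          where
          p∤ : ∀ t → t < p ∸ 1 → ¬ p ∣ suc t + c * p
          p∤ t t<p∸1 p∣ = <⇒≱ (subst (suc t <_) suc[p∸1]≡p (s<s t<p∸1))
                             (∣⇒≤ (∣m+n∣m⇒∣n (subst (p ∣_) (+-comm (suc t) (c * p)) p∣) (n∣m*n c)))

    multiplesᵇ : ℕ → ℕ
    multiplesᵇ a = ∑[ b < d ] ([ p ∣ b ] * χ L a b)

    count₁-∷ : ∀ a → count₁ L a ≡ count₁ (p ∷ L) a + [ p ∣ a ] * multiplesᵇ a
    count₁-∷ a = begin
      ∑[ b < d ] χ L a b                                                 ≡⟨ ∑-cong d (λ b _ → χ-∷ p L a b) ⟩
      ∑[ b < d ] (χ (p ∷ L) a b + [ p ∣ a ] * ([ p ∣ b ] * χ L a b))     ≡⟨ ∑-distrib-+ d _ _ ⟩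
      count₁ (p ∷ L) a + ∑[ b < d ] ([ p ∣ a ] * ([ p ∣ b ] * χ L a b))  ≡⟨ cong (count₁ (p ∷ L) a +_) (∑-distribˡ-* d [ p ∣ a ] _) ⟩
      count₁ (p ∷ L) a + [ p ∣ a ] * multiplesᵇ a                        ∎
      where open ≡-Reasoning

    p*multiplesᵇ : ∀ a → p * multiplesᵇ a ≡ count₁ L a
    p*multiplesᵇ a = p*∑-multiples≡∑ (χ L a) (χ-invariantʳ L a)

    count₁-∷-∣ : ∀ {a} → p ∣ a → p * count₁ (p ∷ L) a + count₁ L a ≡ p * count₁ L a
    count₁-∷-∣ {a} p∣a = sym (begin
      p * count₁ L a                                     ≡⟨ cong (p *_) (count₁-∷ a) ⟩
      p * (count₁ (p ∷ L) a + [ p ∣ a ] * multiplesᵇ a)  ≡⟨ cong (λ x → p * (count₁ (p ∷ L) a + 𝟙 x * multiplesᵇ a)) (dec-true (p ∣? a) p∣a) ⟩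
      p * (count₁ (p ∷ L) a + (multiplesᵇ a + 0))        ≡⟨ *-distribˡ-+ p _ _ ⟩
      p * count₁ (p ∷ L) a + p * (multiplesᵇ a + 0)      ≡⟨ cong (λ x → p * count₁ (p ∷ L) a + p * x) (+-identityʳ _) ⟩
      p * count₁ (p ∷ L) a + p * multiplesᵇ a            ≡⟨ cong (p * count₁ (p ∷ L) a +_) (p*multiplesᵇ a) ⟩
      p * count₁ (p ∷ L) a + count₁ L a                  ∎)
      where open ≡-Reasoning

    count₁-∷-∤ : ∀ {a} → ¬ p ∣ a → count₁ (p ∷ L) a ≡ count₁ L a
    count₁-∷-∤ {a} p∤a = sym (trans (count₁-∷ a) (trans (cong (λ x → count₁ (p ∷ L) a + 𝟙 x * multiplesᵇ a) (dec-false (p ∣? a) p∤a)) (+-identityʳ _)))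

    count₂-∷ : p * p * count₂ (p ∷ L) + count₂ L ≡ p * p * count₂ L
    count₂-∷ = sym (begin
      p * p * count₂ L                                                        ≡⟨ cong (p * p *_) (trans (∑-cong d (λ a _ → count₁-∷ a)) (∑-distrib-+ d _ _)) ⟩
      p * p * (count₂ (p ∷ L) + ∑[ a < d ] ([ p ∣ a ] * multiplesᵇ a))        ≡⟨ *-distribˡ-+ (p * p) _ _ ⟩
      p * p * count₂ (p ∷ L) + p * p * ∑[ a < d ] ([ p ∣ a ] * multiplesᵇ a)  ≡⟨ cong (p * p * count₂ (p ∷ L) +_) multiplesᵃᵇ ⟩
      p * p * count₂ (p ∷ L) + count₂ L                                       ∎)
      where
      open ≡-Reasoning
      open +-*-Solver
      swap-p : ∀ a → p * ([ p ∣ a ] * multiplesᵇ a) ≡ [ p ∣ a ] * count₁ L a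
      swap-p a = trans (solve 3 (λ p x m → p :* (x :* m) := x :* (p :* m)) refl p [ p ∣ a ] (multiplesᵇ a))
                       (cong ([ p ∣ a ] *_) (p*multiplesᵇ a))
      multiplesᵃᵇ : p * p * ∑[ a < d ] ([ p ∣ a ] * multiplesᵇ a) ≡ count₂ L
      multiplesᵃᵇ = begin
        p * p * ∑[ a < d ] ([ p ∣ a ] * multiplesᵇ a)    ≡⟨ *-assoc p p _ ⟩
        p * (p * ∑[ a < d ] ([ p ∣ a ] * multiplesᵇ a))  ≡⟨ cong (p *_) (trans (sym (∑-distribˡ-* d p _)) (∑-cong d (λ a _ → swap-p a))) ⟩
        p * ∑[ a < d ] ([ p ∣ a ] * count₁ L a)          ≡⟨ p*∑-multiples≡∑ (count₁ L) (λ x y x~y → ∑-cong d (λ b _ → χ-invariantˡ L b x y x~y)) ⟩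
        count₂ L                                         ∎

  density : ∀ i L → PrimeDivisorsOfD L → Unique L →
    product (map (λ p → numerator p i) L) * count₂ L ≡ count₁ L i * d * product (map (λ p → denominator p i) L)
  density i [] _ _ = begin
    1 * ∑[ a < d ] ∑[ b < d ] 1  ≡⟨ *-identityˡ _ ⟩
    ∑[ a < d ] ∑[ b < d ] 1      ≡⟨ trans (∑-cong d (λ _ _ → ∑-const d 1)) (∑-const d (d * 1)) ⟩
    d * (d * 1)                  ≡⟨ *-comm d (d * 1) ⟩
    d * 1 * d                    ≡⟨ cong (_* d) (∑-const d 1) ⟨
    ∑[ b < d ] 1 * d             ≡⟨ *-identityʳ _ ⟨
    ∑[ b < d ] 1 * d * 1         ∎
    where open ≡-Reasoning
  density i (p ∷ L) ((p-prime , p∣d) ∷ L-ok) (p∉L ∷ L-unique) = by-cases (p ∣? i)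
    where
    open Sieve p-prime p∣d L-ok p∉L
    N = product (map (λ p → numerator p i) L)
    D = product (map (λ p → denominator p i) L)
    ih = density i L L-ok L-unique
    by-cases : Dec (p ∣ i) → numerator p i * N * count₂ (p ∷ L) ≡ count₁ (p ∷ L) i * d * (denominator p i * D)
    by-cases (yes p∣i) =
      subst₂ (λ x y → x * N * count₂ (p ∷ L) ≡ count₁ (p ∷ L) i * d * (y * D))
             (cong (λ b → if b then p else p * p) (sym (dec-true (p ∣? i) p∣i)))
             (cong (λ b → if b then suc p else suc (p * p ∸ 2)) (sym (dec-true (p ∣? i) p∣i)))
             (density-step-∣ p ⦃ prime⇒nonZero p-prime ⦄ ih count₂-∷ (count₁-∷-∣ p∣i))
    by-cases (no p∤i) =
      subst₂ (λ x y → x * N * count₂ (p ∷ L) ≡ count₁ (p ∷ L) i * d * (y * D))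
             (cong (λ b → if b then p else p * p) (sym (dec-false (p ∣? i) p∤i)))
             (cong (λ b → if b then suc p else suc (p * p ∸ 2)) (sym (dec-false (p ∣? i) p∤i)))
             (density-step-∤ p (nonTrivial⇒n>1 p ⦃ prime⇒nonTrivial p-prime ⦄) ih count₂-∷ (count₁-∷-∤ p∤i))

-- The discrepancy bound

open import Data.Integer.Base as ℤ using (+_)
import Data.Integer.Properties as ℤₚ
open import Data.Rational as ℚ using (ℚ; 0ℚ; 1ℚ)
import Data.Rational.Properties as ℚₚ
import Data.Rational.Unnormalised as ℚᵘ
import Data.Rational.Unnormalised.Properties as ℚᵘₚ
open import Data.Rational.Solver renaming (module +-*-Solver to ℚ-Solver)

bernoulli : ∀ x n → x ^ n * (x + n) ≤ suc x ^ n * x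
bernoulli x zero    = ≤-reflexive (trans (*-identityˡ (x + 0)) (trans (+-identityʳ x) (sym (*-identityˡ x))))
bernoulli x (suc n) = begin
  x * x ^ n * (x + suc n)              ≤⟨ m≤m+n _ (x ^ n * n) ⟩
  x * x ^ n * (x + suc n) + x ^ n * n  ≡⟨ solve 3 (λ x n p → x :* p :* (x :+ (con 1 :+ n)) :+ p :* n := (con 1 :+ x) :* (p :* (x :+ n))) refl x n (x ^ n) ⟩
  suc x * (x ^ n * (x + n))            ≤⟨ *-monoʳ-≤ (suc x) (bernoulli x n) ⟩
  suc x * (suc x ^ n * x)              ≡⟨ *-assoc (suc x) (suc x ^ n) x ⟨
  suc x * suc x ^ n * x                ∎
  where
  open ≤-Reasoning
  open +-*-Solver

-- (1 − 1/(x+1))^(x+1) ≤ 1/2, cleared of denominators.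
2*x^[1+x]≤[1+x]^[1+x] : ∀ x → 0 < x → 2 * x ^ suc x ≤ suc x ^ suc x
2*x^[1+x]≤[1+x]^[1+x] x@(suc _) _ = *-cancelˡ-≤ x (begin
  x * (2 * x ^ suc x)      ≡⟨ solve 2 (λ x p → x :* (con 2 :* p) := p :* (x :+ x)) refl x (x ^ suc x) ⟩
  x ^ suc x * (x + x)      ≤⟨ *-monoʳ-≤ (x ^ suc x) (+-monoʳ-≤ x (n≤1+n x)) ⟩
  x ^ suc x * (x + suc x)  ≤⟨ bernoulli x (suc x) ⟩
  suc x ^ suc x * x        ≡⟨ *-comm _ x ⟩
  x * suc x ^ suc x        ∎)
  where
  open ≤-Reasoning
  open +-*-Solver

∃-⌊log⌋ : ∀ Γ {N} → 1 < Γ → 0 < N → ∃[ j ] Γ ^ j ≤ N × N < Γ ^ suc j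
∃-⌊log⌋ Γ {N} 1<Γ 0<N = search N (<-≤-trans (n<2^n N) (^-monoˡ-≤ N 1<Γ))
  where
  search : ∀ t → N < Γ ^ t → ∃[ j ] Γ ^ j ≤ N × N < Γ ^ suc j
  search zero    N<1 = contradiction 0<N (≤⇒≯ (≤-pred N<1))
  search (suc t) N<Γ^t+1 with N <? Γ ^ t
  ... | yes N<Γ^t = search t N<Γ^t
  ... | no  N≮Γ^t = t , ≮⇒≥ N≮Γ^t , N<Γ^t+1

^-distribʳ-* : ∀ m n k → (m * n) ^ k ≡ m ^ k * n ^ k
^-distribʳ-* m n zero    = refl
^-distribʳ-* m n (suc k) = trans (cong (m * n *_) (^-distribʳ-* m n k))
  (solve 4 (λ m n a b → m :* n :* (a :* b) := m :* a :* (n :* b)) refl m n (m ^ k) (n ^ k))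
  where open +-*-Solver

toℚ : ℕ → ℚ
toℚ n = + n ℚ./ 1

toℚ≡mkℚ : ∀ n → toℚ n ≡ ℚ.mkℚ (+ n) 0 (Coprimality.sym (Coprimality.1-coprimeTo n))
toℚ≡mkℚ n = ℚₚ.normalize-coprime (Coprimality.sym (Coprimality.1-coprimeTo n))

toℚ-* : ∀ m n → toℚ (m * n) ≡ toℚ m ℚ.* toℚ n
toℚ-* m n rewrite toℚ≡mkℚ m | toℚ≡mkℚ n = ℚₚ./-cong (ℤₚ.pos-* m n) refl

toℚ-+ : ∀ m n → toℚ (m + n) ≡ toℚ m ℚ.+ toℚ n
toℚ-+ m n rewrite toℚ≡mkℚ m | toℚ≡mkℚ n =
  ℚₚ./-cong (cong₂ ℤ._+_ (sym (ℤₚ.*-identityʳ (+ m))) (sym (ℤₚ.*-identityʳ (+ n)))) refl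

toℚ-^ : ∀ m n → toℚ (m ^ n) ≡ toℚ m ^ℚ n
toℚ-^ m zero    = refl
toℚ-^ m (suc n) = trans (toℚ-* m (m ^ n)) (cong (toℚ m ℚ.*_) (toℚ-^ m n))

toℚ-mono-≤ : ∀ {m n} → m ≤ n → toℚ m ℚ.≤ toℚ n
toℚ-mono-≤ {m} {n} m≤n rewrite toℚ≡mkℚ m | toℚ≡mkℚ n =
  ℚ.*≤* (subst₂ ℤ._≤_ (sym (ℤₚ.*-identityʳ (+ m))) (sym (ℤₚ.*-identityʳ (+ n))) (ℤ.+≤+ m≤n))

toℚ-positive : ∀ {n} → 0 < n → ℚ.Positive (toℚ n)
toℚ-positive {suc n} _ rewrite toℚ≡mkℚ (suc n) = _

∣toℚ∣ : ∀ n → ℚ.∣ toℚ n ∣ ≡ toℚ n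
∣toℚ∣ n rewrite toℚ≡mkℚ n = refl

[m/n]*n : ∀ m n .{{_ : NonZero n}} → (+ m ℚ./ n) ℚ.* toℚ n ≡ toℚ m
[m/n]*n m n@(suc n-1) = ℚₚ.toℚᵘ-injective (begin
  ℚ.toℚᵘ ((+ m ℚ./ n) ℚ.* toℚ n)          ≈⟨ ℚₚ.toℚᵘ-homo-* (+ m ℚ./ n) (toℚ n) ⟩
  ℚ.toℚᵘ (+ m ℚ./ n) ℚᵘ.* ℚ.toℚᵘ (toℚ n)  ≈⟨ ℚᵘₚ.*-cong (ℚₚ.toℚᵘ-fromℚᵘ (ℚᵘ.mkℚᵘ (+ m) n-1)) (ℚₚ.toℚᵘ-fromℚᵘ (ℚᵘ.mkℚᵘ (+ n) 0)) ⟩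
  ℚᵘ.mkℚᵘ (+ m) n-1 ℚᵘ.* ℚᵘ.mkℚᵘ (+ n) 0  ≈⟨ ℚᵘ.*≡* (trans (ℤₚ.*-identityʳ _) (cong (λ k → + m ℤ.* + k) (sym (*-identityʳ n)))) ⟩
  ℚᵘ.mkℚᵘ (+ m) 0                         ≈⟨ ℚₚ.toℚᵘ-fromℚᵘ (ℚᵘ.mkℚᵘ (+ m) 0) ⟨
  ℚ.toℚᵘ (toℚ m)                          ∎)
  where open ℚᵘₚ.≃-Reasoning

^ℚ-mono-≤ : ∀ {x y} → 0ℚ ℚ.≤ x → x ℚ.≤ y → ∀ n → 0ℚ ℚ.≤ x ^ℚ n × x ^ℚ n ℚ.≤ y ^ℚ n
^ℚ-mono-≤ 0≤x x≤y zero = ℚ.*≤* (ℤ.+≤+ z≤n) , ℚₚ.≤-refl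
^ℚ-mono-≤ {x} {y} 0≤x x≤y (suc n) =
  let 0≤xⁿ , xⁿ≤yⁿ = ^ℚ-mono-≤ 0≤x x≤y n
  in ℚₚ.nonNegative⁻¹ _ {{ℚₚ.nonNeg*nonNeg⇒nonNeg x {{ℚ.nonNegative 0≤x}} (x ^ℚ n) {{ℚ.nonNegative 0≤xⁿ}}}} ,
     ℚₚ.≤-trans (ℚₚ.*-monoʳ-≤-nonNeg (x ^ℚ n) {{ℚ.nonNegative 0≤xⁿ}} x≤y)
               (ℚₚ.*-monoˡ-≤-nonNeg y {{ℚ.nonNegative (ℚₚ.≤-trans 0≤x x≤y)}} xⁿ≤yⁿ)

∣m-r*n∣≤k : ∀ {Z F m n k} (r : ℚ) → 0 < Z → r ℚ.* toℚ Z ≡ toℚ F →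
            Z * m ≤ F * n + Z * k → F * n ≤ Z * m + Z * k → ℚ.∣ toℚ m ℚ.- r ℚ.* toℚ n ∣ ℚ.≤ toℚ k
∣m-r*n∣≤k {Z} {F} {m} {n} {k} r 0<Z rZ≡F upper lower =
  ℚₚ.*-cancelˡ-≤-pos (toℚ Z) {{toℚ-positive 0<Z}} (subst₂ ℚ._≤_ Z*∣x∣ (toℚ-* Z k) ∣Zm-Fn∣≤Zk)
  where
  open ℚ-Solver
  x = toℚ m ℚ.- r ℚ.* toℚ n
  a = toℚ (Z * m)
  b = toℚ (F * n)
  c = toℚ (Z * k)
  Z*x : toℚ Z ℚ.* x ≡ a ℚ.- b
  Z*x = trans (solve 4 (λ z m r n → z :* (m :- r :* n) := z :* m :- (r :* z) :* n) refl (toℚ Z) (toℚ m) r (toℚ n))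
              (cong₂ ℚ._-_ (sym (toℚ-* Z m)) (trans (cong (ℚ._* toℚ n) rZ≡F) (sym (toℚ-* F n))))
  Z*∣x∣ : ℚ.∣ a ℚ.- b ∣ ≡ toℚ Z ℚ.* ℚ.∣ x ∣
  Z*∣x∣ = trans (cong ℚ.∣_∣ (sym Z*x)) (trans (ℚₚ.∣p*q∣≡∣p∣*∣q∣ (toℚ Z) x) (cong (ℚ._* ℚ.∣ x ∣) (∣toℚ∣ Z)))
  a-b≤c : a ℚ.- b ℚ.≤ c
  a-b≤c = subst (a ℚ.- b ℚ.≤_) (solve 2 (λ b c → (b :+ c) :- b := c) refl b c)
                (ℚₚ.+-monoˡ-≤ (ℚ.- b) (subst (a ℚ.≤_) (toℚ-+ (F * n) (Z * k)) (toℚ-mono-≤ upper)))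
  -c≤a-b : ℚ.- c ℚ.≤ a ℚ.- b
  -c≤a-b = subst₂ ℚ._≤_ (solve 2 (λ b c → b :+ (:- c :- b) := :- c) refl b c) (solve 3 (λ a b c → (a :+ c) :+ (:- c :- b) := a :- b) refl a b c)
                 (ℚₚ.+-monoˡ-≤ (ℚ.- c ℚ.- b) (subst (b ℚ.≤_) (toℚ-+ (Z * m) (Z * k)) (toℚ-mono-≤ lower)))
  ∣Zm-Fn∣≤Zk : ℚ.∣ a ℚ.- b ∣ ℚ.≤ c
  ∣Zm-Fn∣≤Zk with ℚₚ.∣p∣≡p∨∣p∣≡-p (a ℚ.- b)
  ... | inj₁ ∣y∣≡y  = subst (ℚ._≤ c) (sym ∣y∣≡y) a-b≤c
  ... | inj₂ ∣y∣≡-y = subst₂ ℚ._≤_ (sym ∣y∣≡-y) (solve 1 (λ c → :- (:- c) := c) refl c) (ℚₚ.neg-antimono-≤ -c≤a-b)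

*-cancelʳ-≡-pos : ∀ {x y} z .{{_ : ℚ.Positive z}} → x ℚ.* z ≡ y ℚ.* z → x ≡ y
*-cancelʳ-≡-pos z xz≡yz = ℚₚ.≤-antisym (ℚₚ.*-cancelʳ-≤-pos z (ℚₚ.≤-reflexive xz≡yz)) (ℚₚ.*-cancelʳ-≤-pos z (ℚₚ.≤-reflexive (sym xz≡yz)))

localFactor≡numerator/denominator : ∀ {p} i → Prime p → localFactor p i ℚ.* toℚ (denominator p i) ≡ toℚ (numerator p i)
localFactor≡numerator/denominator {p@(suc (suc _))} i _ with does (p ∣? i)
... | true  = [m/n]*n p (suc p)
... | false = [m/n]*n (p * p) (suc (p * p ∸ 2))

∏localFactor : List ℕ → ℕ → ℚ
∏localFactor ps i = foldr (λ p acc → localFactor p i ℚ.* acc) 1ℚ ps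

∏localFactor≡∏numerator/∏denominator : ∀ i ps → All Prime ps →
  ∏localFactor ps i ℚ.* toℚ (product (map (λ p → denominator p i) ps)) ≡ toℚ (product (map (λ p → numerator p i) ps))
∏localFactor≡∏numerator/∏denominator i []       []                 = ℚₚ.*-identityˡ 1ℚ
∏localFactor≡∏numerator/∏denominator i (p ∷ ps) (p-prime ∷ ps-prime) = begin
  localFactor p i ℚ.* ∏ ℚ.* toℚ (denominator p i * D)                   ≡⟨ cong (localFactor p i ℚ.* ∏ ℚ.*_) (toℚ-* (denominator p i) D) ⟩
  localFactor p i ℚ.* ∏ ℚ.* (toℚ (denominator p i) ℚ.* toℚ D)           ≡⟨ solve 4 (λ l a b c → l :* a :* (b :* c) := (l :* b) :* (a :* c)) refl (localFactor p i) ∏ (toℚ (denominator p i)) (toℚ D) ⟩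
  (localFactor p i ℚ.* toℚ (denominator p i)) ℚ.* (∏ ℚ.* toℚ D)         ≡⟨ cong₂ ℚ._*_ (localFactor≡numerator/denominator i p-prime) (∏localFactor≡∏numerator/∏denominator i ps ps-prime) ⟩
  toℚ (numerator p i) ℚ.* toℚ (product (map (λ p → numerator p i) ps))  ≡⟨ toℚ-* (numerator p i) _ ⟨
  toℚ (numerator p i * product (map (λ p → numerator p i) ps))          ∎
  where
  open ≡-Reasoning
  open ℚ-Solver
  ∏ = ∏localFactor ps i
  D = product (map (λ p → denominator p i) ps)

module Asymptotics (d : ℕ) (1<d : 1 < d) where
  open SternModulo d 1<d
  open PrimitiveDensity d

  #Primitive≡count₂ : #Primitive ≡ count₂ primes
  #Primitive≡count₂ = ∑-cong d (λ a _ → ∑-cong d (λ b _ → *-identityʳ (χ primes a b)))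

  ∑Primitive-firstIs≡count₁ : ∀ i → ∑Primitive (firstIs i) ≡ count₁ primes i
  ∑Primitive-firstIs≡count₁ i = begin
    ∑[ a < d ] ∑[ b < d ] (χ primes a b * firstIs i (a , b))  ≡⟨ ∑-cong d (λ a a<d → row a a<d) ⟩
    ∑[ a < d ] (𝟙 (does (a ≟ i % d)) * count₁ primes a)       ≡⟨ ∑-select d (count₁ primes) (m%n<n i d) ⟩
    count₁ primes (i % d)                                     ≡⟨ ∑-cong d (λ b _ → χ-invariantˡ primes b (i % d) i (All.tabulate (λ p∈ → mk⇔ (∣%⇒∣ p∈) (∣⇒∣% p∈)))) ⟩
    count₁ primes i                                           ∎
    where
    open ≡-Reasoning
    row : ∀ a → a < d → ∑[ b < d ] (χ primes a b * firstIs i (a , b)) ≡ 𝟙 (does (a ≟ i % d)) * count₁ primes a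
    row a a<d = begin
      ∑[ b < d ] (χ primes a b * 𝟙 (does (a % d ≟ i % d)))  ≡⟨ ∑-cong d (λ b _ → *-comm (χ primes a b) _) ⟩
      ∑[ b < d ] (𝟙 (does (a % d ≟ i % d)) * χ primes a b)  ≡⟨ ∑-distribˡ-* d (𝟙 (does (a % d ≟ i % d))) (χ primes a) ⟩
      𝟙 (does (a % d ≟ i % d)) * count₁ primes a            ≡⟨ cong (λ x → 𝟙 (does (x ≟ i % d)) * count₁ primes a) (m<n⇒m%n≡m a<d) ⟩
      𝟙 (does (a ≟ i % d)) * count₁ primes a                ∎

  0<#Primitive : 0 < #Primitive
  0<#Primitive = ≤-trans (≤-reflexive (sym origin-counted)) (≤-trans (term≤∑ d _ 1<d) (term≤∑ d _ (<-trans z<s 1<d)))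
    where
    origin-counted : χ primes 0 1 * 1 ≡ 1
    origin-counted = trans (*-identityʳ _) (cong 𝟙 (dec-true (noCommonPrime? primes 0 1)
                       (All.tabulate (λ p∈ (_ , p∣1) → ¬prime[1] (subst Prime (∣1⇒≡1 p∣1) (proj₁ (∈-primeDivisors⁻ d p∈)))))))

  r*#Primitive≡∑Primitive-firstIs : ∀ i → r d i ℚ.* toℚ #Primitive ≡ toℚ (∑Primitive (firstIs i))
  r*#Primitive≡∑Primitive-firstIs i = *-cancelʳ-≡-pos (toℚ D) {{toℚ-positive 0<D}} (begin
    1/d ℚ.* ∏ ℚ.* toℚ Z ℚ.* toℚ D          ≡⟨ solve 4 (λ a b c e → a :* b :* c :* e := a :* (b :* e) :* c) refl 1/d ∏ (toℚ Z) (toℚ D) ⟩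
    1/d ℚ.* (∏ ℚ.* toℚ D) ℚ.* toℚ Z        ≡⟨ cong (λ x → 1/d ℚ.* x ℚ.* toℚ Z) (∏localFactor≡∏numerator/∏denominator i primes primes-prime) ⟩
    1/d ℚ.* toℚ N ℚ.* toℚ Z                ≡⟨ trans (ℚₚ.*-assoc 1/d (toℚ N) (toℚ Z)) (cong (1/d ℚ.*_) (sym (toℚ-* N Z))) ⟩
    1/d ℚ.* toℚ (N * Z)                    ≡⟨ cong (λ x → 1/d ℚ.* toℚ x) N*Z≡F*d*D ⟩
    1/d ℚ.* toℚ (F * d * D)                ≡⟨ cong (1/d ℚ.*_) (trans (toℚ-* (F * d) D) (cong (ℚ._* toℚ D) (toℚ-* F d))) ⟩
    1/d ℚ.* (toℚ F ℚ.* toℚ d ℚ.* toℚ D)    ≡⟨ solve 4 (λ a f e n → a :* (f :* e :* n) := (a :* e) :* (f :* n)) refl 1/d (toℚ F) (toℚ d) (toℚ D) ⟩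
    (1/d ℚ.* toℚ d) ℚ.* (toℚ F ℚ.* toℚ D)  ≡⟨ cong (ℚ._* (toℚ F ℚ.* toℚ D)) ([m/n]*n 1 d) ⟩
    1ℚ ℚ.* (toℚ F ℚ.* toℚ D)               ≡⟨ ℚₚ.*-identityˡ _ ⟩
    toℚ F ℚ.* toℚ D                        ∎)
    where
    open ≡-Reasoning
    open ℚ-Solver
    1/d = + 1 ℚ./ d
    ∏ = ∏localFactor primes i
    Z = #Primitive
    F = ∑Primitive (firstIs i)
    N = product (map (λ p → numerator p i) primes)
    D = product (map (λ p → denominator p i) primes)
    primes-ok : PrimeDivisorsOfD primes
    primes-ok = All.tabulate (∈-primeDivisors⁻ d)
    primes-prime : All Prime primes
    primes-prime = All.map proj₁ primes-ok
    0<D : 0 < D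
    0<D = 0<∏denominator i primes
    N*Z≡F*d*D : N * Z ≡ F * d * D
    N*Z≡F*d*D = trans (cong (N *_) #Primitive≡count₂)
                      (trans (density i primes primes-ok (primeDivisors-unique d)) (cong (λ f → f * d * D) (sym (∑Primitive-firstIs≡count₁ i))))

  ∣T-rN∣≤blockError : ∀ i j N → ℚ.∣ toℚ (T N d i) ℚ.- r d i ℚ.* toℚ N ∣ ℚ.≤ toℚ (blockError j N)
  ∣T-rN∣≤blockError i j N =
    let upper , lower = discrepancy i j N
    in ∣m-r*n∣≤k {#Primitive} {∑Primitive (firstIs i)} {T N d i} {N} {blockError j N} (r d i) 0<#Primitive (r*#Primitive≡∑Primitive-firstIs i) upper lower

  A : ℕ
  A = 2 ^ reachBound

  τ-num τ-den Γ : ℕ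
  τ-num = A * reachBound
  τ-den = suc τ-num
  Γ     = 2 ^ τ-den

  -- By Bernoulli's inequality 2 W^A ≤ A^A: every A rounds of reachBound steps halve the relative error.
  2^j*W^[j*A]≤2^[j*τ-num] : ∀ j → 2 ^ j * W ^ (j * A) ≤ 2 ^ (j * A * reachBound)
  2^j*W^[j*A]≤2^[j*τ-num] j = begin
    2 ^ j * W ^ (j * A)         ≡⟨ cong (λ k → 2 ^ j * W ^ k) (*-comm j A) ⟩
    2 ^ j * W ^ (A * j)         ≡⟨ cong (2 ^ j *_) (^-*-assoc W A j) ⟨
    2 ^ j * (W ^ A) ^ j         ≡⟨ ^-distribʳ-* 2 (W ^ A) j ⟨
    (2 * W ^ A) ^ j             ≡⟨ cong (λ a → (2 * W ^ a) ^ j) 2^reachBound≡1+W ⟩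
    (2 * W ^ suc W) ^ j         ≤⟨ ^-monoˡ-≤ j (2*x^[1+x]≤[1+x]^[1+x] W 0<W) ⟩
    (suc W ^ suc W) ^ j         ≡⟨ cong (λ a → (a ^ a) ^ j) 2^reachBound≡1+W ⟨
    (A ^ A) ^ j                 ≡⟨ cong (_^ j) (^-*-assoc 2 reachBound A) ⟩
    (2 ^ (reachBound * A)) ^ j  ≡⟨ ^-*-assoc 2 (reachBound * A) j ⟩
    2 ^ (reachBound * A * j)    ≡⟨ cong (2 ^_) (solve 3 (λ m a j → m :* a :* j := j :* a :* m) refl reachBound A j) ⟩
    2 ^ (j * A * reachBound)    ∎
    where
    open ≤-Reasoning
    open +-*-Solver
    0<W : 0 < W
    0<W = ≤-pred (subst (2 ≤_) 2^reachBound≡1+W (^-monoʳ-≤ 2 {1} {reachBound} (≤-trans (<-trans z<s 1<d) (≤-trans (m≤n+m d (2 * d * d)) (m≤m+n _ (2 * d * d))))))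

  Γ^[1+j]≡2^j*[Γ*2^[j*τ-num]] : ∀ j → Γ ^ suc j ≡ 2 ^ j * (Γ * 2 ^ (j * A * reachBound))
  Γ^[1+j]≡2^j*[Γ*2^[j*τ-num]] j = begin
    Γ * (2 ^ τ-den) ^ j                     ≡⟨ cong (Γ *_) (^-*-assoc 2 τ-den j) ⟩
    Γ * 2 ^ (j + τ-num * j)                 ≡⟨ cong (Γ *_) (^-distribˡ-+-* 2 j (τ-num * j)) ⟩
    Γ * (2 ^ j * 2 ^ (τ-num * j))           ≡⟨ cong (λ k → Γ * (2 ^ j * 2 ^ k)) (solve 3 (λ a m j → a :* m :* j := j :* a :* m) refl A reachBound j) ⟩
    Γ * (2 ^ j * 2 ^ (j * A * reachBound))  ≡⟨ solve 3 (λ g x b → g :* (x :* b) := x :* (g :* b)) refl Γ (2 ^ j) (2 ^ (j * A * reachBound)) ⟩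
    2 ^ j * (Γ * 2 ^ (j * A * reachBound))  ∎
    where
    open ≡-Reasoning
    open +-*-Solver

  2^[j*τ-num]^τ-den≡[Γ^j]^τ-num : ∀ j → (2 ^ (j * A * reachBound)) ^ τ-den ≡ (Γ ^ j) ^ τ-num
  2^[j*τ-num]^τ-den≡[Γ^j]^τ-num j = begin
    (2 ^ (j * A * reachBound)) ^ τ-den  ≡⟨ ^-*-assoc 2 (j * A * reachBound) τ-den ⟩
    2 ^ (j * A * reachBound * τ-den)    ≡⟨ cong (2 ^_) (solve 4 (λ j a m e → j :* a :* m :* e := e :* j :* (a :* m)) refl j A reachBound τ-den) ⟩
    2 ^ (τ-den * j * τ-num)             ≡⟨ ^-*-assoc 2 (τ-den * j) τ-num ⟨
    (2 ^ (τ-den * j)) ^ τ-num           ≡⟨ cong (_^ τ-num) (^-*-assoc 2 τ-den j) ⟨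
    (Γ ^ j) ^ τ-num                     ∎
    where
    open ≡-Reasoning
    open +-*-Solver

  -- Choosing Γ ^ j ≤ N < Γ ^ (j + 1) balances the two parts of the block error.
  blockError-bound : ∀ N → 0 < N → ∃[ k ] blockError k N ^ τ-den ≤ suc Γ ^ τ-den * N ^ τ-num
  blockError-bound N 0<N =
    let j , Γ^j≤N , N<Γ^[1+j] = ∃-⌊log⌋ Γ (^-monoʳ-≤ 2 {1} {τ-den} (s≤s z≤n)) 0<N
        k = j * A
        B = 2 ^ (k * reachBound)
        instance
          B≢0 : NonZero B
          B≢0 = m^n≢0 2 (k * reachBound)
        M*W^k<Γ*B : N / B * W ^ k < Γ * B
        M*W^k<Γ*B = *-cancelˡ-< (2 ^ j) _ _ (begin-strict
          2 ^ j * (N / B * W ^ k)  ≡⟨ solve 3 (λ x m w → x :* (m :* w) := m :* (x :* w)) refl (2 ^ j) (N / B) (W ^ k) ⟩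
          N / B * (2 ^ j * W ^ k)  ≤⟨ *-monoʳ-≤ (N / B) (2^j*W^[j*A]≤2^[j*τ-num] j) ⟩
          N / B * B                ≤⟨ m/n*n≤m N B ⟩
          N                        <⟨ N<Γ^[1+j] ⟩
          Γ ^ suc j                ≡⟨ Γ^[1+j]≡2^j*[Γ*2^[j*τ-num]] j ⟩
          2 ^ j * (Γ * B)          ∎)
        blockError≤ : blockError k N ≤ suc Γ * B
        blockError≤ = subst (blockError k N ≤_) (+-comm (Γ * B) B) (+-mono-≤ (<⇒≤ M*W^k<Γ*B) (<⇒≤ (m%n<n N B)))
    in k , (begin
      blockError k N ^ τ-den           ≤⟨ ^-monoˡ-≤ τ-den blockError≤ ⟩
      (suc Γ * B) ^ τ-den              ≡⟨ ^-distribʳ-* (suc Γ) B τ-den ⟩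
      suc Γ ^ τ-den * B ^ τ-den        ≡⟨ cong (suc Γ ^ τ-den *_) (2^[j*τ-num]^τ-den≡[Γ^j]^τ-num j) ⟩
      suc Γ ^ τ-den * (Γ ^ j) ^ τ-num  ≤⟨ *-monoʳ-≤ (suc Γ ^ τ-den) (^-monoˡ-≤ τ-num Γ^j≤N) ⟩
      suc Γ ^ τ-den * N ^ τ-num        ∎)
    where
    open ≤-Reasoning
    open +-*-Solver

  discrepancy-bound : ∀ i N → 0 < N →
    ℚ.∣ toℚ (T N d i) ℚ.- r d i ℚ.* toℚ N ∣ ^ℚ τ-den ℚ.≤ toℚ (suc Γ ^ τ-den) ℚ.* toℚ N ^ℚ τ-num
  discrepancy-bound i N 0<N =
    let k , bound = blockError-bound N 0<N
        x = toℚ (T N d i) ℚ.- r d i ℚ.* toℚ N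
        _ , ∣x∣^τ-den≤ = ^ℚ-mono-≤ (ℚₚ.nonNegative⁻¹ ℚ.∣ x ∣ {{ℚₚ.∣-∣-nonNeg x}}) (∣T-rN∣≤blockError i k N) τ-den
    in ℚₚ.≤-trans ∣x∣^τ-den≤
         (subst₂ ℚ._≤_ (toℚ-^ (blockError k N) τ-den)
                       (trans (toℚ-* (suc Γ ^ τ-den) (N ^ τ-num)) (cong (toℚ (suc Γ ^ τ-den) ℚ.*_) (toℚ-^ N τ-num)))
                       (toℚ-mono-≤ bound))

corollary4p8 : (d : ℕ) → .{{_ : NonZero d}} → 2 ≤ d →
    Σ ℕ λ a → Σ ℕ λ b → a < b ×
      ((i : ℕ) → i < d →
        Σ ℚ λ C → Σ ℕ λ N₀ → (N : ℕ) → N₀ ≤ N →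
          (ℚ.∣ (+ T N d i) ℚ./ 1 ℚ.- r d i ℚ.* ((+ N) ℚ./ 1) ∣ ^ℚ b)
            ℚ.≤ C ℚ.* (((+ N) ℚ./ 1) ^ℚ a))
corollary4p8 d 1<d = τ-num , τ-den , ≤-refl , λ i _ → toℚ (suc Γ ^ τ-den) , 1 , discrepancy-bound i
  where open Asymptotics d 1<d
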